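{- Let $n\ge1$ and $(m_1,\dots,m_n)$ a sequence of positive integers. Then $$L(m_1,\dots,m_n)=\sum_{\substack{(j_2,\dots,j_n)\in\mathbb{Z}^{n-1}\\ 0\le j_a\le m_a}}\ \prod_{a=2}^{n}\binom{m_1+j_2+\cdots+j_{a-1}}{m_a-j_a}$$ and $$R(m_1,\dots,m_n)=\sum_{(j_2,\dots,j_n)\in\{0,1\}^{n-1}}\ \prod_{a=2}^{n}\binom{m_a+j_2+\cdots+j_{a-1}}{m_a-j_a}.$$
   Context: $\mathcal{A}_n=\{1<\cdots<n\}$. A composition diagram is a finite left-to-right sequence of nonempty bottom-justified columns of boxes; the bottom row consists of the lowest boxes. An lps tableau over $\mathcal{A}_n$: filling by elements of $\mathcal{A}_n$ with columns strictly increasing bottom to top and bottom row weakly increasing left to right. An rps tableau: columns weakly increasing bottom to top and bottom row strictly increasing left to right. $L(m_1,\dots,m_n)$ (resp. $R(m_1,\dots,m_n)$) is the number of lps (resp. rps) tableaux over $\mathcal{A}_n$ in which each symbol $a$ occurs exactly $m_a$ times. Convention: $\binom{m}{k}=0$ for $k>m$; empty products equal $1$. -}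

module Defs where

open import Data.Nat using (ℕ; zero; suc; _+_; _*_; _∸_)
open import Data.Nat.Combinatorics using (_C_)
open import Data.Fin using (Fin; zero; suc; _<?_)
import Data.Fin as F
open import Data.List using (List; []; _∷_; [_]; map; concatMap; upTo; allFin; filter; length)
open import Data.Nat.ListAction using (sum; product)
open import Data.List.NonEmpty using (List⁺; head; toList)
open import Data.List.Relation.Unary.Linked using (Linked)
open import Data.Vec using (Vec; []; _∷_; lookup; tabulate)
open import Data.Fin.Properties using (_≟_)
open import Data.Product using (Σ; _×_)
open import Relation.Binary.PropositionalEquality using (_≡_)

-- Symbols of 𝒜ₙ = {1 < ⋯ < n} are represented by Fin n (index i ↔ symbol i+1).

-- A filled composition diagram: a finite left-to-right list of nonempty
-- columns; each column is listed bottom to top.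
Filling : ℕ → Set
Filling n = List (List⁺ (Fin n))

bottomRow : ∀ {n} → Filling n → List (Fin n)
bottomRow = map head

entries : ∀ {n} → Filling n → List (Fin n)
entries = concatMap toList

occ : ∀ {n} → Fin n → Filling n → ℕ
occ a T = length (filter (a ≟_) (entries T))

-- each symbol a occurs exactly m a times (stated as one equality of
-- content vectors, which is equivalent to ∀ a → occ a T ≡ m a)
HasContent : ∀ {n} → (Fin n → ℕ) → Filling n → Set
HasContent m T = tabulate (λ a → occ a T) ≡ tabulate m

data AllCols {n} (P : List⁺ (Fin n) → Set) : Filling n → Set where
  []  : AllCols P []
  _∷_ : ∀ {c cs} → P c → AllCols P cs → AllCols P (c ∷ cs)

IsLPS : ∀ {n} → Filling n → Set
IsLPS T = AllCols (λ c → Linked F._<_ (toList c)) T × Linked F._≤_ (bottomRow T)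

IsRPS : ∀ {n} → Filling n → Set
IsRPS T = AllCols (λ c → Linked F._≤_ (toList c)) T × Linked F._<_ (bottomRow T)

LPS : ∀ n → (Fin n → ℕ) → Set
LPS n m = Σ (Filling n) (λ T → IsLPS T × HasContent m T)

RPS : ∀ n → (Fin n → ℕ) → Set
RPS n m = Σ (Filling n) (λ T → IsRPS T × HasContent m T)

box : ∀ k → (Fin k → ℕ) → List (Vec ℕ k)
box zero    b = [ [] ]
box (suc k) b = concatMap (λ x → map (x ∷_) (box k (λ i → b (suc i)))) (upTo (suc (b zero)))

prefixSum : ∀ {k} → Vec ℕ k → Fin k → ℕ
prefixSum {k} j a = sum (map (lookup j) (filter (_<? a) (allFin k)))

-- Here m : Fin (suc k) → ℕ encodes (m₁,…,mₙ) with n = suc k; index a : Fin k of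
-- j encodes j_{a+2}, and m (suc a) = m_{a+2}.

Lformula : ∀ k → (Fin (suc k) → ℕ) → ℕ
Lformula k m = sum (map (λ j → product (map (λ a → (m zero + prefixSum j a) C (m (suc a) ∸ lookup j a)) (allFin k)))
                        (box k (λ a → m (suc a))))

Rformula : ∀ k → (Fin (suc k) → ℕ) → ℕ
Rformula k m = sum (map (λ j → product (map (λ a → (m (suc a) + prefixSum j a) C (m (suc a) ∸ lookup j a)) (allFin k)))
                        (box k (λ _ → 1)))

-- Remove every occurrence of the least symbol. In an lps tableau it can only sit at the bottom of
-- columns, and these columns form a left prefix of the diagram; once the symbol is deleted they
-- become headless columns, still subject to the column condition but no longer to the bottom-row
-- condition. So one counts, more generally, tableaux preceded by c headless columns. In such an
-- lps object the least symbol occurs at most once in each headless column and at the bottom of a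
-- prefix of x ordinary columns; deleting it leaves an object over the remaining symbols with c + x
-- headless columns, and the occurrences in the old headless columns form a 0/1-word of length c
-- with m₁ − x ones. Hence L_c(m₁,…,mₙ) = Σ_x C(c, m₁ − x) L_{c+x}(m₂,…,mₙ), which unfolds to the
-- stated sum. For rps tableaux the strict bottom row forces x ≤ 1, while the weakly increasing
-- columns may hold the least symbol many times: its occurrences form a weak composition of m₁ − x
-- into c + x parts, counted by C(m₁ − x + c + x − 1, m₁ − x).

module Submission where

open import Defs
open import Data.Nat as ℕ using (ℕ; zero; suc; _+_; _*_; _∸_; _<_; z≤n; s≤s)
import Data.Nat.Properties as ℕP
open import Data.Nat.Combinatorics using (_C_; nCk+nC[k+1]≡[n+1]C[k+1]; nCn≡1)
open import Data.Nat.ListAction using (sum; product)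
open import Data.Nat.ListAction.Properties using (sum-++)
open import Data.Fin as F using (Fin; zero; suc; toℕ; fromℕ<; _<?_)
import Data.Fin.Properties as FP
open import Data.Fin.Properties using (_≟_)
open import Data.List
  using (List; []; _∷_; _++_; map; concat; concatMap; replicate; length; filter; zipWith; take; drop; applyUpTo; upTo; allFin)
import Data.List.Properties as Listₚ
open import Data.List.NonEmpty as List⁺ using (List⁺; _∷_; toList)
open import Data.List.Relation.Unary.All as All using (All; []; _∷_)
import Data.List.Relation.Unary.All.Properties as Allₚ
open import Data.List.Relation.Unary.Linked as Linked using (Linked; []; [-]; _∷_)
import Data.List.Relation.Unary.Linked.Properties as Linkedₚ
open import Data.Vec as Vec using (Vec; _∷_; lookup)
import Data.Vec.Properties as Vecₚ
open import Data.Product using (Σ; _×_; _,_; proj₁; proj₂; zip′)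
open import Data.Product.Function.NonDependent.Propositional using (_×-↔_)
open import Data.Sum using (_⊎_; inj₁; inj₂)
open import Data.Sum.Function.Propositional using (_⊎-↔_)
open import Data.Unit using (⊤; tt)
open import Data.Empty using (⊥-elim)
open import Data.Bool using (true; false)
open import Function using (_∘_; _∘′_; id)
open import Function.Bundles using (_↔_; mk↔ₛ′)
open import Function.Properties.Inverse using (↔-sym; ↔-trans; ↔-refl)
open import Axiom.UniquenessOfIdentityProofs using (module Decidable⇒UIP)
open import Relation.Nullary using (¬_; does; yes; no)
open import Relation.Nullary.Irrelevant using (Irrelevant)
open import Relation.Binary.PropositionalEquality

-- Counting by explicit bijections

×-irrelevant : {A B : Set} → Irrelevant A → Irrelevant B → Irrelevant (A × B)
×-irrelevant irrA irrB (a , b) (a′ , b′) = cong₂ _,_ (irrA a a′) (irrB b b′)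

Σ-≡-irrelevant : {A : Set} {P : A → Set} → (∀ a → Irrelevant (P a)) →
  {a b : A} {p : P a} {q : P b} → a ≡ b → _≡_ {A = Σ A P} (a , p) (b , q)
Σ-≡-irrelevant irr {a} {p = p} {q} refl = cong (a ,_) (irr a p q)

Σ-restrict-↔ : {A B : Set} {P : A → Set} {Q : B → Set} (f : A → B) (g : B → A) →
  (∀ a → P a → Q (f a)) → (∀ b → Q b → P (g b)) →
  (∀ a → P a → g (f a) ≡ a) → (∀ b → Q b → f (g b) ≡ b) →
  (∀ a → Irrelevant (P a)) → (∀ b → Irrelevant (Q b)) → Σ A P ↔ Σ B Q
Σ-restrict-↔ f g fP gQ gf fg irrP irrQ = mk↔ₛ′
  (λ (a , p) → f a , fP a p) (λ (b , q) → g b , gQ b q)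
  (λ (b , q) → Σ-≡-irrelevant irrQ (fg b q)) (λ (a , p) → Σ-≡-irrelevant irrP (gf a p))

contractible-↔-Fin1 : {A : Set} (a : A) → (∀ x → x ≡ a) → A ↔ Fin 1
contractible-↔-Fin1 a centre = mk↔ₛ′ (λ _ → zero) (λ _ → a) (λ { zero → refl }) (λ x → sym (centre x))

empty-↔-Fin0 : {A : Set} → ¬ A → A ↔ Fin 0
empty-↔-Fin0 ¬a = mk↔ₛ′ (λ x → ⊥-elim (¬a x)) (λ ()) (λ ()) (λ x → ⊥-elim (¬a x))

Fin-cong : {a b : ℕ} → a ≡ b → Fin a ↔ Fin b
Fin-cong refl = ↔-refl

×-↔-Fin : {A B : Set} {a b : ℕ} → A ↔ Fin a → B ↔ Fin b → (A × B) ↔ Fin (a * b)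
×-↔-Fin A↔a B↔b = ↔-trans (A↔a ×-↔ B↔b) (↔-sym FP.*↔×)

sumFin : ∀ r → (Fin r → ℕ) → ℕ
sumFin zero    f = 0
sumFin (suc r) f = f zero + sumFin r (λ i → f (suc i))

Σ-↔-sumFin : ∀ r (f : Fin r → ℕ) {P : Fin r → Set} → (∀ i → P i ↔ Fin (f i)) → Σ (Fin r) P ↔ Fin (sumFin r f)
Σ-↔-sumFin zero    f P↔f = empty-↔-Fin0 λ { (() , _) }
Σ-↔-sumFin (suc r) f {P} P↔f =
  ↔-trans Σ-split (↔-trans (P↔f zero ⊎-↔ Σ-↔-sumFin r (λ i → f (suc i)) (λ i → P↔f (suc i))) (↔-sym FP.+↔⊎))
  where
  Σ-split : Σ (Fin (suc r)) P ↔ (P zero ⊎ Σ (Fin r) (λ i → P (suc i)))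
  Σ-split = mk↔ₛ′ to from (λ { (inj₁ _) → refl ; (inj₂ _) → refl }) (λ { (zero , _) → refl ; (suc _ , _) → refl })
    where
    to : Σ (Fin (suc r)) P → P zero ⊎ Σ (Fin r) (λ i → P (suc i))
    to (zero  , p) = inj₁ p
    to (suc i , p) = inj₂ (i , p)
    from : P zero ⊎ Σ (Fin r) (λ i → P (suc i)) → Σ (Fin (suc r)) P
    from (inj₁ p)       = zero , p
    from (inj₂ (i , p)) = suc i , p

bounded-↔-Fin : (Q : ℕ → Set) (m : ℕ) → Σ ℕ (λ x → x ℕ.≤ m × Q x) ↔ Σ (Fin (suc m)) (λ i → Q (toℕ i))
bounded-↔-Fin Q m = mk↔ₛ′ to from to∘from from∘to
  where
  to : Σ ℕ (λ x → x ℕ.≤ m × Q x) → Σ (Fin (suc m)) (λ i → Q (toℕ i))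
  to (x , x≤m , q) = fromℕ< (s≤s x≤m) , subst Q (sym (FP.toℕ-fromℕ< (s≤s x≤m))) q
  from : Σ (Fin (suc m)) (λ i → Q (toℕ i)) → Σ ℕ (λ x → x ℕ.≤ m × Q x)
  from (i , q) = toℕ i , ℕP.≤-pred (FP.toℕ<n i) , q
  transport-ℕ : ∀ {x y} (e : y ≡ x) (x≤m : x ℕ.≤ m) (y≤m : y ℕ.≤ m) (q : Q x) →
    _≡_ {A = Σ ℕ (λ x → x ℕ.≤ m × Q x)} (y , y≤m , subst Q (sym e) q) (x , x≤m , q)
  transport-ℕ refl x≤m y≤m q = cong (λ le → _ , le , q) (ℕP.≤-irrelevant y≤m x≤m)
  transport-Fin : ∀ {i j : Fin (suc m)} (e : j ≡ i) (e′ : toℕ i ≡ toℕ j) (q : Q (toℕ i)) →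
    _≡_ {A = Σ (Fin (suc m)) (λ i → Q (toℕ i))} (j , subst Q e′ q) (i , q)
  transport-Fin {i} refl e′ q = cong (λ e → i , subst Q e q) (ℕP.≡-irrelevant e′ refl)
  from∘to : ∀ x → from (to x) ≡ x
  from∘to (x , x≤m , q) = transport-ℕ (FP.toℕ-fromℕ< (s≤s x≤m)) x≤m _ q
  to∘from : ∀ y → to (from y) ≡ y
  to∘from (i , q) = transport-Fin (FP.fromℕ<-toℕ i _) _ q

inhabited-irrelevant-×-↔ : {P A : Set} → P → Irrelevant P → (P × A) ↔ A
inhabited-irrelevant-×-↔ p irr = mk↔ₛ′ (λ (_ , a) → a) (p ,_) (λ _ → refl) (λ (q , a) → cong (_, a) (irr p q))

IsWeakComposition : ℕ → ℕ → List ℕ → Set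
IsWeakComposition c r ts = length ts ≡ c × sum ts ≡ r

IsBinaryWord : ℕ → ℕ → List ℕ → Set
IsBinaryWord c r ts = IsWeakComposition c r ts × All (ℕ._≤ 1) ts

IsWeakComposition-irrelevant : ∀ c r ts → Irrelevant (IsWeakComposition c r ts)
IsWeakComposition-irrelevant c r ts = ×-irrelevant ℕP.≡-irrelevant ℕP.≡-irrelevant

IsBinaryWord-irrelevant : ∀ c r ts → Irrelevant (IsBinaryWord c r ts)
IsBinaryWord-irrelevant c r ts =
  ×-irrelevant (IsWeakComposition-irrelevant c r ts) (All.irrelevant ℕP.≤-irrelevant)

WeakComposition BinaryWord : ℕ → ℕ → Set
WeakComposition c r = Σ (List ℕ) (IsWeakComposition c r)
BinaryWord      c r = Σ (List ℕ) (IsBinaryWord c r)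

binaryWord-↔-Fin : ∀ c r → BinaryWord c r ↔ Fin (c C r)
binaryWord-↔-Fin zero zero = contractible-↔-Fin1 ([] , (refl , refl) , [])
  λ { ([] , _) → Σ-≡-irrelevant (IsBinaryWord-irrelevant 0 0) refl }
binaryWord-↔-Fin zero (suc r) = empty-↔-Fin0 λ { ([] , (_ , ()) , _) }
binaryWord-↔-Fin (suc c) zero = ↔-trans consZero (binaryWord-↔-Fin c 0)
  where
  consZero : BinaryWord (suc c) 0 ↔ BinaryWord c 0
  consZero = mk↔ₛ′ (λ { (zero ∷ ts , (l , s) , _ ∷ b) → ts , (ℕP.suc-injective l , s) , b })
    (λ (ts , (l , s) , b) → 0 ∷ ts , (cong suc l , s) , z≤n ∷ b)
    (λ _ → Σ-≡-irrelevant (IsBinaryWord-irrelevant c 0) refl)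
    (λ { (zero ∷ ts , (_ , _) , _ ∷ _) → Σ-≡-irrelevant (IsBinaryWord-irrelevant (suc c) 0) refl })
binaryWord-↔-Fin (suc c) (suc r) =
  ↔-trans firstLetter (↔-trans (binaryWord-↔-Fin c r ⊎-↔ binaryWord-↔-Fin c (suc r))
    (↔-trans (↔-sym FP.+↔⊎) (Fin-cong (nCk+nC[k+1]≡[n+1]C[k+1] c r))))
  where
  to : BinaryWord (suc c) (suc r) → BinaryWord c r ⊎ BinaryWord c (suc r)
  to (1 ∷ ts , (l , s) , _ ∷ b) = inj₁ (ts , (ℕP.suc-injective l , ℕP.suc-injective s) , b)
  to (0 ∷ ts , (l , s) , _ ∷ b) = inj₂ (ts , (ℕP.suc-injective l , s) , b)
  to (suc (suc _) ∷ _ , _ , s≤s () ∷ _)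
  from : BinaryWord c r ⊎ BinaryWord c (suc r) → BinaryWord (suc c) (suc r)
  from (inj₁ (ts , (l , s) , b)) = 1 ∷ ts , (cong suc l , cong suc s) , s≤s z≤n ∷ b
  from (inj₂ (ts , (l , s) , b)) = 0 ∷ ts , (cong suc l , s) , z≤n ∷ b
  firstLetter : BinaryWord (suc c) (suc r) ↔ (BinaryWord c r ⊎ BinaryWord c (suc r))
  firstLetter = mk↔ₛ′ to from
    (λ { (inj₁ _) → cong inj₁ (Σ-≡-irrelevant (IsBinaryWord-irrelevant c r) refl)
       ; (inj₂ _) → cong inj₂ (Σ-≡-irrelevant (IsBinaryWord-irrelevant c (suc r)) refl) })
    (λ { (1 ∷ _ , (_ , _) , _ ∷ _) → Σ-≡-irrelevant (IsBinaryWord-irrelevant (suc c) (suc r)) refl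
       ; (0 ∷ _ , (_ , _) , _ ∷ _) → Σ-≡-irrelevant (IsBinaryWord-irrelevant (suc c) (suc r)) refl
       ; (suc (suc _) ∷ _ , _ , s≤s () ∷ _) })

multichoose : ℕ → ℕ → ℕ
multichoose zero    zero    = 1
multichoose zero    (suc r) = 0
multichoose (suc c) zero    = multichoose c zero
multichoose (suc c) (suc r) = multichoose c (suc r) + multichoose (suc c) r

weakComposition-↔-Fin : ∀ c r → WeakComposition c r ↔ Fin (multichoose c r)
weakComposition-↔-Fin zero zero = contractible-↔-Fin1 ([] , refl , refl)
  λ { ([] , _) → Σ-≡-irrelevant (IsWeakComposition-irrelevant 0 0) refl }
weakComposition-↔-Fin zero (suc r) = empty-↔-Fin0 λ { ([] , _ , ()) }
weakComposition-↔-Fin (suc c) zero = ↔-trans consZero (weakComposition-↔-Fin c 0)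
  where
  consZero : WeakComposition (suc c) 0 ↔ WeakComposition c 0
  consZero = mk↔ₛ′ (λ { (zero ∷ ts , l , s) → ts , ℕP.suc-injective l , s })
    (λ (ts , l , s) → 0 ∷ ts , cong suc l , s)
    (λ _ → Σ-≡-irrelevant (IsWeakComposition-irrelevant c 0) refl)
    (λ { (zero ∷ ts , _ , _) → Σ-≡-irrelevant (IsWeakComposition-irrelevant (suc c) 0) refl })
weakComposition-↔-Fin (suc c) (suc r) =
  ↔-trans firstPart (↔-trans (weakComposition-↔-Fin c (suc r) ⊎-↔ weakComposition-↔-Fin (suc c) r) (↔-sym FP.+↔⊎))
  where
  to : WeakComposition (suc c) (suc r) → WeakComposition c (suc r) ⊎ WeakComposition (suc c) r
  to (zero  ∷ ts , l , s) = inj₁ (ts , ℕP.suc-injective l , s)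
  to (suc t ∷ ts , l , s) = inj₂ (t ∷ ts , l , ℕP.suc-injective s)
  from : WeakComposition c (suc r) ⊎ WeakComposition (suc c) r → WeakComposition (suc c) (suc r)
  from (inj₁ (ts , l , s))     = 0 ∷ ts , cong suc l , s
  from (inj₂ (t ∷ ts , l , s)) = suc t ∷ ts , l , cong suc s
  firstPart : WeakComposition (suc c) (suc r) ↔ (WeakComposition c (suc r) ⊎ WeakComposition (suc c) r)
  firstPart = mk↔ₛ′ to from
    (λ { (inj₁ _) → cong inj₁ (Σ-≡-irrelevant (IsWeakComposition-irrelevant c (suc r)) refl)
       ; (inj₂ (_ ∷ _ , _ , _)) → cong inj₂ (Σ-≡-irrelevant (IsWeakComposition-irrelevant (suc c) r) refl) })
    (λ { (zero ∷ _ , _ , _) → Σ-≡-irrelevant (IsWeakComposition-irrelevant (suc c) (suc r)) refl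
       ; (suc _ ∷ _ , _ , _) → Σ-≡-irrelevant (IsWeakComposition-irrelevant (suc c) (suc r)) refl })

multichoose-1 : ∀ r → multichoose 1 r ≡ 1
multichoose-1 zero    = refl
multichoose-1 (suc r) = multichoose-1 r

multichoose-suc : ∀ d r → multichoose (suc d) r ≡ (r + d) C r
multichoose-suc zero    zero = refl
multichoose-suc (suc d) zero = multichoose-suc d zero
multichoose-suc zero (suc r) = begin
  multichoose 1 (suc r)    ≡⟨ multichoose-1 (suc r) ⟩
  1                        ≡⟨ sym (nCn≡1 (suc r)) ⟩
  suc r C suc r            ≡⟨ cong (_C suc r) (sym (ℕP.+-identityʳ (suc r))) ⟩
  (suc r + 0) C suc r      ∎
  where open ≡-Reasoning
multichoose-suc (suc d) (suc r) = begin
  multichoose (suc d) (suc r) + multichoose (suc (suc d)) r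
    ≡⟨ cong₂ _+_ (multichoose-suc d (suc r)) (multichoose-suc (suc d) r) ⟩
  (suc r + d) C suc r + (r + suc d) C r
    ≡⟨ cong (λ n → n C suc r + (r + suc d) C r) (sym (ℕP.+-suc r d)) ⟩
  (r + suc d) C suc r + (r + suc d) C r
    ≡⟨ ℕP.+-comm ((r + suc d) C suc r) _ ⟩
  (r + suc d) C r + (r + suc d) C suc r
    ≡⟨ nCk+nC[k+1]≡[n+1]C[k+1] (r + suc d) r ⟩
  suc (r + suc d) C suc r ∎
  where open ≡-Reasoning

m+n≡o⇒n≤o : ∀ m {n o} → m + n ≡ o → n ℕ.≤ o
m+n≡o⇒n≤o m {n} refl = ℕP.m≤n+m n m

m+n≡o⇒m≡o∸n : ∀ m n {o} → m + n ≡ o → m ≡ o ∸ n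
m+n≡o⇒m≡o∸n m n refl = sym (ℕP.m+n∸n≡m m n)

m≡o∸n⇒m+n≡o : ∀ {m n o} → n ℕ.≤ o → m ≡ o ∸ n → m + n ≡ o
m≡o∸n⇒m+n≡o n≤o refl = ℕP.m∸n+n≡m n≤o

-- Words over a finite alphabet with a least letter

lower : ∀ {n} → List (Fin (suc n)) → List (Fin n)
lower []          = []
lower (zero  ∷ l) = lower l
lower (suc a ∷ l) = a ∷ lower l

countOf : ∀ {n} → Fin n → List (Fin n) → ℕ
countOf a l = length (filter (a ≟_) l)

zeros : ∀ {n} → List (Fin (suc n)) → ℕ
zeros = countOf zero

raise : ∀ {n} → ℕ → List (Fin n) → List (Fin (suc n))
raise t l = replicate t zero ++ map suc l

countOf-suc : ∀ {n} (a : Fin n) l → countOf (suc a) l ≡ countOf a (lower l)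
countOf-suc a []          = refl
countOf-suc a (zero  ∷ l) = countOf-suc a l
countOf-suc a (suc b ∷ l) with does (a ≟ b)
... | true  = cong suc (countOf-suc a l)
... | false = countOf-suc a l

zeros-++ : ∀ {n} (xs ys : List (Fin (suc n))) → zeros (xs ++ ys) ≡ zeros xs + zeros ys
zeros-++ []           ys = refl
zeros-++ (zero  ∷ xs) ys = cong suc (zeros-++ xs ys)
zeros-++ (suc _ ∷ xs) ys = zeros-++ xs ys

lower-++ : ∀ {n} (xs ys : List (Fin (suc n))) → lower (xs ++ ys) ≡ lower xs ++ lower ys
lower-++ []           ys = refl
lower-++ (zero  ∷ xs) ys = lower-++ xs ys
lower-++ (suc a ∷ xs) ys = cong (a ∷_) (lower-++ xs ys)

zeros-concat : ∀ {n} (xss : List (List (Fin (suc n)))) → zeros (concat xss) ≡ sum (map zeros xss)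
zeros-concat []         = refl
zeros-concat (xs ∷ xss) = trans (zeros-++ xs (concat xss)) (cong (zeros xs +_) (zeros-concat xss))

lower-concat : ∀ {n} (xss : List (List (Fin (suc n)))) → lower (concat xss) ≡ concat (map lower xss)
lower-concat []         = refl
lower-concat (xs ∷ xss) = trans (lower-++ xs (concat xss)) (cong (lower xs ++_) (lower-concat xss))

lower-map-suc : ∀ {n} (l : List (Fin n)) → lower (map suc l) ≡ l
lower-map-suc []      = refl
lower-map-suc (a ∷ l) = cong (a ∷_) (lower-map-suc l)

zeros-map-suc : ∀ {n} (l : List (Fin n)) → zeros (map suc l) ≡ 0
zeros-map-suc []      = refl
zeros-map-suc (_ ∷ l) = zeros-map-suc l

lower-raise : ∀ {n} t (l : List (Fin n)) → lower (raise t l) ≡ l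
lower-raise zero    l = lower-map-suc l
lower-raise (suc t) l = lower-raise t l

zeros-raise : ∀ {n} t (l : List (Fin n)) → zeros (raise t l) ≡ t
zeros-raise zero    l = zeros-map-suc l
zeros-raise (suc t) l = cong suc (zeros-raise t l)

Sorted≤ Sorted< : ∀ {n} → List (Fin n) → Set
Sorted≤ = Linked F._≤_
Sorted< = Linked F._<_

Sorted<⇒Sorted≤ : ∀ {n} {l : List (Fin n)} → Sorted< l → Sorted≤ l
Sorted<⇒Sorted≤ = Linked.map ℕP.<⇒≤

Sorted≤-map-suc⁺ : ∀ {n} {l : List (Fin n)} → Sorted≤ l → Sorted≤ (map suc l)
Sorted≤-map-suc⁺ = Linkedₚ.map⁺ ∘′ Linked.map s≤s

Sorted≤-map-suc⁻ : ∀ {n} {l : List (Fin n)} → Sorted≤ (map suc l) → Sorted≤ l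
Sorted≤-map-suc⁻ = Linked.map ℕ.s≤s⁻¹ ∘′ Linkedₚ.map⁻

Sorted<-map-suc⁺ : ∀ {n} {l : List (Fin n)} → Sorted< l → Sorted< (map suc l)
Sorted<-map-suc⁺ = Linkedₚ.map⁺ ∘′ Linked.map s≤s

Sorted<-map-suc⁻ : ∀ {n} {l : List (Fin n)} → Sorted< (map suc l) → Sorted< l
Sorted<-map-suc⁻ = Linked.map ℕ.s≤s⁻¹ ∘′ Linkedₚ.map⁻

Linked-++⁻ʳ : ∀ {A : Set} {R : A → A → Set} (xs : List A) {ys} → Linked R (xs ++ ys) → Linked R ys
Linked-++⁻ʳ []       lk = lk
Linked-++⁻ʳ (x ∷ xs) lk = Linked-++⁻ʳ xs (Linked.tail lk)

Sorted≤-zero∷⁺ : ∀ {n} {l : List (Fin (suc n))} → Sorted≤ l → Sorted≤ (zero ∷ l)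
Sorted≤-zero∷⁺ []         = [-]
Sorted≤-zero∷⁺ [-]        = z≤n ∷ [-]
Sorted≤-zero∷⁺ (le ∷ lk)  = z≤n ∷ le ∷ lk

Sorted≤-replicate-zero⁺ : ∀ {n} k {l : List (Fin (suc n))} → Sorted≤ l → Sorted≤ (replicate k zero ++ l)
Sorted≤-replicate-zero⁺ zero    lk = lk
Sorted≤-replicate-zero⁺ (suc k) lk = Sorted≤-zero∷⁺ (Sorted≤-replicate-zero⁺ k lk)

Sorted≤-raise⁺ : ∀ {n} t {l : List (Fin n)} → Sorted≤ l → Sorted≤ (raise t l)
Sorted≤-raise⁺ t lk = Sorted≤-replicate-zero⁺ t (Sorted≤-map-suc⁺ lk)

Sorted≤-raise⁻ : ∀ {n} t {l : List (Fin n)} → Sorted≤ (raise t l) → Sorted≤ l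
Sorted≤-raise⁻ t lk = Sorted≤-map-suc⁻ (Linked-++⁻ʳ (replicate t zero) lk)

Sorted<-zero∷map-suc⁺ : ∀ {n} (l : List (Fin n)) → Sorted< l → Sorted< (zero ∷ map suc l)
Sorted<-zero∷map-suc⁺ []      _  = [-]
Sorted<-zero∷map-suc⁺ (_ ∷ _) lk = s≤s z≤n ∷ Sorted<-map-suc⁺ lk

Sorted<-raise⁺ : ∀ {n} t (l : List (Fin n)) → t ℕ.≤ 1 → Sorted< l → Sorted< (raise t l)
Sorted<-raise⁺ zero          l _          lk = Sorted<-map-suc⁺ lk
Sorted<-raise⁺ (suc zero)    l _          lk = Sorted<-zero∷map-suc⁺ l lk
Sorted<-raise⁺ (suc (suc t)) l (s≤s ()) lk

Sorted<-raise⁻ : ∀ {n} t (l : List (Fin n)) → Sorted< (raise t l) → t ℕ.≤ 1 × Sorted< l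
Sorted<-raise⁻ zero          l lk       = z≤n , Sorted<-map-suc⁻ lk
Sorted<-raise⁻ (suc zero)    l lk       = s≤s z≤n , Sorted<-map-suc⁻ (Linked.tail lk)
Sorted<-raise⁻ (suc (suc t)) l (() ∷ _)

Sorted≤-suc∷⇒map-suc-lower : ∀ {n} (a : Fin n) l → Sorted≤ (suc a ∷ l) → map suc (lower l) ≡ l
Sorted≤-suc∷⇒map-suc-lower a []          _        = refl
Sorted≤-suc∷⇒map-suc-lower a (zero  ∷ l) (() ∷ _)
Sorted≤-suc∷⇒map-suc-lower a (suc b ∷ l) (_ ∷ lk) = cong (suc b ∷_) (Sorted≤-suc∷⇒map-suc-lower b l lk)

Sorted≤⇒raise-zeros-lower : ∀ {n} (l : List (Fin (suc n))) → Sorted≤ l → raise (zeros l) (lower l) ≡ l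
Sorted≤⇒raise-zeros-lower []          _  = refl
Sorted≤⇒raise-zeros-lower (zero  ∷ l) lk = cong (zero ∷_) (Sorted≤⇒raise-zeros-lower l (Linked.tail lk))
Sorted≤⇒raise-zeros-lower (suc a ∷ l) lk = begin
  raise (zeros l) (a ∷ lower l)  ≡⟨ cong (λ t → raise t (a ∷ lower l)) noZeros ⟩
  suc a ∷ map suc (lower l)      ≡⟨ cong (suc a ∷_) tail≡ ⟩
  suc a ∷ l                      ∎
  where
  open ≡-Reasoning
  tail≡ : map suc (lower l) ≡ l
  tail≡ = Sorted≤-suc∷⇒map-suc-lower a l lk
  noZeros : zeros l ≡ 0
  noZeros = trans (cong zeros (sym tail≡)) (zeros-map-suc (lower l))

Content : ∀ n → List (Fin n) → (Fin n → ℕ) → Set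
Content zero    l m = ⊤
Content (suc n) l m = zeros l ≡ m zero × Content n (lower l) (λ a → m (suc a))

Content-irrelevant : ∀ n l m → Irrelevant (Content n l m)
Content-irrelevant zero    l m tt tt = refl
Content-irrelevant (suc n) l m = ×-irrelevant ℕP.≡-irrelevant (Content-irrelevant n (lower l) _)

Content⇒countOf : ∀ n l m → Content n l m → ∀ a → countOf a l ≡ m a
Content⇒countOf (suc n) l m (z , _) zero    = z
Content⇒countOf (suc n) l m (_ , c) (suc a) = trans (countOf-suc a l) (Content⇒countOf n (lower l) _ c a)

countOf⇒Content : ∀ n l m → (∀ a → countOf a l ≡ m a) → Content n l m
countOf⇒Content zero    l m _     = tt
countOf⇒Content (suc n) l m count =
  count zero , countOf⇒Content n (lower l) _ (λ a → trans (sym (countOf-suc a l)) (count (suc a)))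

map-zeros-zipWith-raise : ∀ {n} ts (L : List (List (Fin n))) → length ts ≡ length L → map zeros (zipWith raise ts L) ≡ ts
map-zeros-zipWith-raise []       []      _   = refl
map-zeros-zipWith-raise (t ∷ ts) (l ∷ L) len =
  cong₂ _∷_ (zeros-raise t l) (map-zeros-zipWith-raise ts L (ℕP.suc-injective len))

map-lower-zipWith-raise : ∀ {n} ts (L : List (List (Fin n))) → length ts ≡ length L → map lower (zipWith raise ts L) ≡ L
map-lower-zipWith-raise []       []      _   = refl
map-lower-zipWith-raise (t ∷ ts) (l ∷ L) len =
  cong₂ _∷_ (lower-raise t l) (map-lower-zipWith-raise ts L (ℕP.suc-injective len))

take-++ : {A : Set} (xs ys : List A) {c : ℕ} → length xs ≡ c → take c (xs ++ ys) ≡ xs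
take-++ []       []       refl = refl
take-++ []       (_ ∷ _)  refl = refl
take-++ (x ∷ xs) ys       refl = cong (x ∷_) (take-++ xs ys refl)

drop-++ : {A : Set} (xs ys : List A) {c : ℕ} → length xs ≡ c → drop c (xs ++ ys) ≡ ys
drop-++ []       ys refl = refl
drop-++ (x ∷ xs) ys refl = drop-++ xs ys refl

length-take-+ : {A : Set} (c x : ℕ) (B : List A) → length B ≡ c + x → length (take c B) ≡ c
length-take-+ c x B len = trans (Listₚ.length-take c B) (trans (cong (c ℕ.⊓_) len) (ℕP.m≤n⇒m⊓n≡m (ℕP.m≤m+n c x)))

length-drop-+ : {A : Set} (c x : ℕ) (B : List A) → length B ≡ c + x → length (drop c B) ≡ x
length-drop-+ c x B len = trans (Listₚ.length-drop c B) (trans (cong (_∸ c) len) (ℕP.m+n∸m≡n c x))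

length-zipWith-≡ : {A B C : Set} (f : A → B → C) (xs : List A) (ys : List B) →
  length xs ≡ length ys → length (zipWith f xs ys) ≡ length xs
length-zipWith-≡ f xs ys len =
  trans (Listₚ.length-zipWith f xs ys) (trans (cong (length xs ℕ.⊓_) (sym len)) (ℕP.⊓-idem (length xs)))

Sorted<-zero∷⇒map-suc-lower : ∀ {n} (l : List (Fin (suc n))) → Sorted< (zero ∷ l) → map suc (lower l) ≡ l
Sorted<-zero∷⇒map-suc-lower []          _        = refl
Sorted<-zero∷⇒map-suc-lower (zero  ∷ l) (() ∷ _)
Sorted<-zero∷⇒map-suc-lower (suc b ∷ l) (_ ∷ lk) = cong (suc b ∷_) (Sorted≤-suc∷⇒map-suc-lower b l (Sorted<⇒Sorted≤ lk))

zipWith-raise-zeros-lower : ∀ {n} (B : List (List (Fin (suc n)))) → All Sorted≤ B → zipWith raise (map zeros B) (map lower B) ≡ B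
zipWith-raise-zeros-lower []      []       = refl
zipWith-raise-zeros-lower (b ∷ B) (s ∷ ss) = cong₂ _∷_ (Sorted≤⇒raise-zeros-lower b s) (zipWith-raise-zeros-lower B ss)

All-Sorted<-zipWith-raise⁻ : ∀ {n} ts (L : List (List (Fin n))) → length ts ≡ length L →
  All Sorted< (zipWith raise ts L) → All (ℕ._≤ 1) ts × All Sorted< L
All-Sorted<-zipWith-raise⁻ []       []      _   []       = [] , []
All-Sorted<-zipWith-raise⁻ (t ∷ ts) (l ∷ L) len (s ∷ ss) =
  zip′ _∷_ _∷_ (Sorted<-raise⁻ t l s) (All-Sorted<-zipWith-raise⁻ ts L (ℕP.suc-injective len) ss)

All-Sorted<-zipWith-raise⁺ : ∀ {n} ts (L : List (List (Fin n))) → length ts ≡ length L →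
  All (ℕ._≤ 1) ts → All Sorted< L → All Sorted< (zipWith raise ts L)
All-Sorted<-zipWith-raise⁺ []       []      _   _            _        = []
All-Sorted<-zipWith-raise⁺ (t ∷ ts) (l ∷ L) len (t≤1 ∷ ts≤1) (s ∷ ss) =
  Sorted<-raise⁺ t l t≤1 s ∷ All-Sorted<-zipWith-raise⁺ ts L (ℕP.suc-injective len) ts≤1 ss

All-Sorted≤-zipWith-raise⁻ : ∀ {n} ts (L : List (List (Fin n))) → length ts ≡ length L →
  All Sorted≤ (zipWith raise ts L) → All Sorted≤ L
All-Sorted≤-zipWith-raise⁻ []       []      _   []       = []
All-Sorted≤-zipWith-raise⁻ (t ∷ ts) (l ∷ L) len (s ∷ ss) =
  Sorted≤-raise⁻ t s ∷ All-Sorted≤-zipWith-raise⁻ ts L (ℕP.suc-injective len) ss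

All-Sorted≤-zipWith-raise⁺ : ∀ {n} ts (L : List (List (Fin n))) → length ts ≡ length L →
  All Sorted≤ L → All Sorted≤ (zipWith raise ts L)
All-Sorted≤-zipWith-raise⁺ []       []      _   _        = []
All-Sorted≤-zipWith-raise⁺ (t ∷ ts) (l ∷ L) len (s ∷ ss) =
  Sorted≤-raise⁺ t s ∷ All-Sorted≤-zipWith-raise⁺ ts L (ℕP.suc-injective len) ss

map-lower-map-map-suc : ∀ {n} (X : List (List (Fin n))) → map lower (map (map suc) X) ≡ X
map-lower-map-map-suc []      = refl
map-lower-map-map-suc (x ∷ X) = cong₂ _∷_ (lower-map-suc x) (map-lower-map-map-suc X)

-- Tableaux preceded by headless columns

-- The headless columns, each listed bottom to top, followed by the filling.
Partial : ℕ → Set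
Partial n = List (List (Fin n)) × Filling n

partialEntries : ∀ {n} → Partial n → List (Fin n)
partialEntries (B , E) = concat B ++ entries E

splitZeroColumns : ∀ {n} → Filling (suc n) → List (List (Fin (suc n))) × Filling (suc n)
splitZeroColumns []                = [] , []
splitZeroColumns ((zero ∷ l) ∷ E)  = l ∷ proj₁ (splitZeroColumns E) , proj₂ (splitZeroColumns E)
splitZeroColumns ((suc a ∷ l) ∷ E) = [] , (suc a ∷ l) ∷ E

liftColumn : ∀ {n} → List⁺ (Fin n) → List⁺ (Fin (suc n))
liftColumn = List⁺.map suc

lowerColumn : ∀ {n} → List⁺ (Fin (suc n)) → Filling n
lowerColumn c with lower (toList c)
... | []    = []
... | a ∷ l = (a ∷ l) ∷ []

lowerFilling : ∀ {n} → Filling (suc n) → Filling n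
lowerFilling E = concat (map lowerColumn E)

zeroColumns : ∀ {n} → List (List (Fin (suc n))) → Filling (suc n)
zeroColumns = map (zero ∷_)

splitZeroColumns-++ : ∀ {n} (Y : List (List (Fin (suc n)))) (E : Filling n) →
  splitZeroColumns (zeroColumns Y ++ map liftColumn E) ≡ (Y , map liftColumn E)
splitZeroColumns-++ []      []           = refl
splitZeroColumns-++ []      ((_ ∷ _) ∷ _) = refl
splitZeroColumns-++ (y ∷ Y) E = cong (λ p → y ∷ proj₁ p , proj₂ p) (splitZeroColumns-++ Y E)

lowerFilling-map-liftColumn : ∀ {n} (E : Filling n) → lowerFilling (map liftColumn E) ≡ E
lowerFilling-map-liftColumn []            = refl
lowerFilling-map-liftColumn ((a ∷ l) ∷ E)
  rewrite lower-map-suc l = cong ((a ∷ l) ∷_) (lowerFilling-map-liftColumn E)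

bottomRow-zeroColumns-++ : ∀ {n} (Y : List (List (Fin (suc n)))) (E : Filling n) →
  bottomRow (zeroColumns Y ++ map liftColumn E) ≡ raise (length Y) (bottomRow E)
bottomRow-zeroColumns-++ []      []            = refl
bottomRow-zeroColumns-++ []      ((a ∷ _) ∷ E) = cong (suc a ∷_) (bottomRow-zeroColumns-++ [] E)
bottomRow-zeroColumns-++ (_ ∷ Y) E             = cong (zero ∷_) (bottomRow-zeroColumns-++ Y E)

zeros-entries-zeroColumns-++ : ∀ {n} (Y : List (List (Fin (suc n)))) (E : Filling n) →
  zeros (entries (zeroColumns Y ++ map liftColumn E)) ≡ zeros (concat Y) + length Y
zeros-entries-zeroColumns-++ [] [] = refl
zeros-entries-zeroColumns-++ [] ((a ∷ l) ∷ E) =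
  trans (zeros-++ (map suc l) _) (cong₂ _+_ (zeros-map-suc l) (zeros-entries-zeroColumns-++ [] E))
zeros-entries-zeroColumns-++ (y ∷ Y) E = begin
  suc (zeros (y ++ entries (zeroColumns Y ++ map liftColumn E)))
    ≡⟨ cong suc (trans (zeros-++ y _) (cong (zeros y +_) (zeros-entries-zeroColumns-++ Y E))) ⟩
  suc (zeros y + (zeros (concat Y) + length Y))
    ≡⟨ cong suc (sym (ℕP.+-assoc (zeros y) _ _)) ⟩
  suc (zeros y + zeros (concat Y) + length Y)
    ≡⟨ sym (ℕP.+-suc _ (length Y)) ⟩
  zeros y + zeros (concat Y) + suc (length Y)
    ≡⟨ cong (_+ suc (length Y)) (sym (zeros-++ y (concat Y))) ⟩
  zeros (y ++ concat Y) + suc (length Y) ∎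
  where open ≡-Reasoning

lower-entries-zeroColumns-++ : ∀ {n} (Y : List (List (Fin (suc n)))) (E : Filling n) →
  lower (entries (zeroColumns Y ++ map liftColumn E)) ≡ lower (concat Y) ++ entries E
lower-entries-zeroColumns-++ [] [] = refl
lower-entries-zeroColumns-++ [] ((a ∷ l) ∷ E) =
  cong (a ∷_) (trans (lower-++ (map suc l) _) (cong₂ _++_ (lower-map-suc l) (lower-entries-zeroColumns-++ [] E)))
lower-entries-zeroColumns-++ (y ∷ Y) E = begin
  lower (y ++ entries (zeroColumns Y ++ map liftColumn E))
    ≡⟨ trans (lower-++ y _) (cong (lower y ++_) (lower-entries-zeroColumns-++ Y E)) ⟩
  lower y ++ (lower (concat Y) ++ entries E)
    ≡⟨ sym (Listₚ.++-assoc (lower y) _ _) ⟩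
  (lower y ++ lower (concat Y)) ++ entries E
    ≡⟨ cong (_++ entries E) (sym (lower-++ y (concat Y))) ⟩
  lower (y ++ concat Y) ++ entries E ∎
  where open ≡-Reasoning

zeros-partialEntries : ∀ {n} (P Y : List (List (Fin (suc n)))) (E : Filling n) →
  zeros (partialEntries (P , zeroColumns Y ++ map liftColumn E)) ≡ zeros (concat (P ++ Y)) + length Y
zeros-partialEntries P Y E = begin
  zeros (concat P ++ entries (zeroColumns Y ++ map liftColumn E))
    ≡⟨ trans (zeros-++ (concat P) _) (cong (zeros (concat P) +_) (zeros-entries-zeroColumns-++ Y E)) ⟩
  zeros (concat P) + (zeros (concat Y) + length Y)
    ≡⟨ sym (ℕP.+-assoc (zeros (concat P)) _ _) ⟩
  zeros (concat P) + zeros (concat Y) + length Y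
    ≡⟨ cong (_+ length Y) (trans (sym (zeros-++ (concat P) _)) (cong zeros (Listₚ.concat-++ P Y))) ⟩
  zeros (concat (P ++ Y)) + length Y ∎
  where open ≡-Reasoning

lower-partialEntries : ∀ {n} (P Y : List (List (Fin (suc n)))) (E : Filling n) →
  lower (partialEntries (P , zeroColumns Y ++ map liftColumn E)) ≡ lower (concat (P ++ Y)) ++ entries E
lower-partialEntries P Y E = begin
  lower (concat P ++ entries (zeroColumns Y ++ map liftColumn E))
    ≡⟨ trans (lower-++ (concat P) _) (cong (lower (concat P) ++_) (lower-entries-zeroColumns-++ Y E)) ⟩
  lower (concat P) ++ (lower (concat Y) ++ entries E)
    ≡⟨ sym (Listₚ.++-assoc (lower (concat P)) _ _) ⟩
  (lower (concat P) ++ lower (concat Y)) ++ entries E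
    ≡⟨ cong (_++ entries E) (trans (sym (lower-++ (concat P) _)) (cong lower (Listₚ.concat-++ P Y))) ⟩
  lower (concat (P ++ Y)) ++ entries E ∎
  where open ≡-Reasoning

map-liftColumn-lowerFilling : ∀ {n} (a : Fin n) l (E : Filling (suc n)) →
  All (Sorted≤ ∘ toList) ((suc a ∷ l) ∷ E) → Sorted≤ (bottomRow ((suc a ∷ l) ∷ E)) →
  map liftColumn (lowerFilling ((suc a ∷ l) ∷ E)) ≡ (suc a ∷ l) ∷ E
map-liftColumn-lowerFilling a l [] (col ∷ _) _ =
  cong (λ t → (suc a ∷ t) ∷ []) (Sorted≤-suc∷⇒map-suc-lower a l col)
map-liftColumn-lowerFilling a l ((zero ∷ _) ∷ _) _ (() ∷ _)
map-liftColumn-lowerFilling a l ((suc b ∷ l′) ∷ E) (col ∷ cols) (_ ∷ bot) =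
  cong₂ _∷_ (cong (suc a ∷_) (Sorted≤-suc∷⇒map-suc-lower a l col)) (map-liftColumn-lowerFilling b l′ E cols bot)

splitZeroColumns-inverse : ∀ {n} (E : Filling (suc n)) → All (Sorted≤ ∘ toList) E → Sorted≤ (bottomRow E) →
  zeroColumns (proj₁ (splitZeroColumns E)) ++ map liftColumn (lowerFilling (proj₂ (splitZeroColumns E))) ≡ E
splitZeroColumns-inverse []                _            _   = refl
splitZeroColumns-inverse ((zero ∷ l) ∷ E)  (_ ∷ cols)   bot =
  cong ((zero ∷ l) ∷_) (splitZeroColumns-inverse E cols (Linked.tail bot))
splitZeroColumns-inverse ((suc a ∷ l) ∷ E) cols         bot = map-liftColumn-lowerFilling a l E cols bot

AllCols⇒All : ∀ {n} {P : List⁺ (Fin n) → Set} {T} → AllCols P T → All P T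
AllCols⇒All []       = []
AllCols⇒All (p ∷ ps) = p ∷ AllCols⇒All ps

All⇒AllCols : ∀ {n} {P : List⁺ (Fin n) → Set} {T} → All P T → AllCols P T
All⇒AllCols []       = []
All⇒AllCols (p ∷ ps) = p ∷ All⇒AllCols ps

AllCols-irrelevant : ∀ {n} {P : List⁺ (Fin n) → Set} → (∀ c → Irrelevant (P c)) → ∀ T → Irrelevant (AllCols P T)
AllCols-irrelevant irr []      []       []       = refl
AllCols-irrelevant irr (c ∷ T) (p ∷ ps) (q ∷ qs) = cong₂ _∷_ (irr c p q) (AllCols-irrelevant irr T ps qs)

HasContent-irrelevant : ∀ {n} (m : Fin n → ℕ) T → Irrelevant (HasContent m T)
HasContent-irrelevant m T = Decidable⇒UIP.≡-irrelevant (Vecₚ.≡-dec ℕP._≟_)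

HasContent⇒Content : ∀ {n} (m : Fin n → ℕ) T → HasContent m T → Content n (entries T) m
HasContent⇒Content m T h = countOf⇒Content _ (entries T) m λ a → begin
  occ a T                                 ≡⟨ sym (Vecₚ.lookup∘tabulate (λ a → occ a T) a) ⟩
  lookup (Vec.tabulate (λ a → occ a T)) a ≡⟨ cong (λ v → lookup v a) h ⟩
  lookup (Vec.tabulate m) a               ≡⟨ Vecₚ.lookup∘tabulate m a ⟩
  m a                                     ∎
  where open ≡-Reasoning

Content⇒HasContent : ∀ {n} (m : Fin n → ℕ) T → Content n (entries T) m → HasContent m T
Content⇒HasContent m T c = Vecₚ.tabulate-cong (Content⇒countOf _ (entries T) m c)

module Tableaux (_≺_ _⊏_ : ∀ {k} → Fin k → Fin k → Set)
  (≺-irrelevant : ∀ {k} {a b : Fin k} → Irrelevant (a ≺ b))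
  (⊏-irrelevant : ∀ {k} {a b : Fin k} → Irrelevant (a ⊏ b)) where

  IsTableau : ∀ {n} → Filling n → Set
  IsTableau T = AllCols (Linked _≺_ ∘ toList) T × Linked _⊏_ (bottomRow T)

  Valid : ∀ n → (Fin n → ℕ) → Partial n → Set
  Valid n m (B , E) =
    All (Linked _≺_) B × All (Linked _≺_ ∘ toList) E × Linked _⊏_ (bottomRow E) × Content n (partialEntries (B , E)) m

  IsPartialTableau : ∀ n → ℕ → (Fin n → ℕ) → Partial n → Set
  IsPartialTableau n c m r = length (proj₁ r) ≡ c × Valid n m r

  PartialTableau : ∀ n → ℕ → (Fin n → ℕ) → Set
  PartialTableau n c m = Σ (Partial n) (IsPartialTableau n c m)

  Valid-irrelevant : ∀ n m r → Irrelevant (Valid n m r)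
  Valid-irrelevant n m (B , E) =
    ×-irrelevant (All.irrelevant (Linked.irrelevant ≺-irrelevant))
    (×-irrelevant (All.irrelevant (Linked.irrelevant ≺-irrelevant))
    (×-irrelevant (Linked.irrelevant ⊏-irrelevant) (Content-irrelevant n _ m)))

  IsPartialTableau-irrelevant : ∀ n c m r → Irrelevant (IsPartialTableau n c m r)
  IsPartialTableau-irrelevant n c m r = ×-irrelevant ℕP.≡-irrelevant (Valid-irrelevant n m r)

  tableau-↔-partialTableau : ∀ n m →
    Σ (Filling n) (λ T → IsTableau T × HasContent m T) ↔ PartialTableau n 0 m
  tableau-↔-partialTableau n m = Σ-restrict-↔ ([] ,_) proj₂ toValid fromValid (λ _ _ → refl) noColumns
    (λ T → ×-irrelevant (×-irrelevant (AllCols-irrelevant (λ _ → Linked.irrelevant ≺-irrelevant) T)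
                                      (Linked.irrelevant ⊏-irrelevant))
                        (HasContent-irrelevant m T))
    (IsPartialTableau-irrelevant n 0 m)
    where
    toValid : ∀ T → IsTableau T × HasContent m T → IsPartialTableau n 0 m ([] , T)
    toValid T ((cols , bot) , content) = refl , [] , AllCols⇒All cols , bot , HasContent⇒Content m T content
    fromValid : ∀ r → IsPartialTableau n 0 m r → IsTableau (proj₂ r) × HasContent m (proj₂ r)
    fromValid ([] , E) (_ , _ , cols , bot , content) = (All⇒AllCols cols , bot) , Content⇒HasContent m E content
    noColumns : ∀ r → IsPartialTableau n 0 m r → ([] , proj₂ r) ≡ r
    noColumns ([] , E) _ = refl

  partialTableau₀-↔-Fin1 : ∀ c m → PartialTableau 0 c m ↔ Fin 1
  partialTableau₀-↔-Fin1 c m = contractible-↔-Fin1 onlyEmptyColumns centre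
    where
    emptyColumns : ∀ c → All (Linked _≺_) (replicate c [])
    emptyColumns zero    = []
    emptyColumns (suc c) = [] ∷ emptyColumns c
    onlyEmpty : (B : List (List (Fin 0))) → B ≡ replicate (length B) []
    onlyEmpty []              = refl
    onlyEmpty ([] ∷ B)        = cong ([] ∷_) (onlyEmpty B)
    onlyEmpty ((() ∷ _) ∷ _)
    onlyEmptyColumns : PartialTableau 0 c m
    onlyEmptyColumns = (replicate c [] , []) , Listₚ.length-replicate c , emptyColumns c , [] , [] , tt
    centre : ∀ t → t ≡ onlyEmptyColumns
    centre ((B , []) , len , _) = Σ-≡-irrelevant (IsPartialTableau-irrelevant 0 c m)
      (cong (_, []) (trans (onlyEmpty B) (cong (λ k → replicate k []) len)))
    centre ((_ , (() ∷ _) ∷ _) , _)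

map-map-suc-lower-zeroColumnTails : ∀ {n} (E : Filling (suc n)) → All (Sorted< ∘ toList) E →
  map (map suc) (map lower (proj₁ (splitZeroColumns E))) ≡ proj₁ (splitZeroColumns E)
map-map-suc-lower-zeroColumnTails []                _          = refl
map-map-suc-lower-zeroColumnTails ((zero ∷ l) ∷ E)  (col ∷ cols) =
  cong₂ _∷_ (Sorted<-zero∷⇒map-suc-lower l col) (map-map-suc-lower-zeroColumnTails E cols)
map-map-suc-lower-zeroColumnTails ((suc _ ∷ _) ∷ _) _          = refl

zeroColumnTails-Sorted≤ : ∀ {n} (E : Filling (suc n)) → All (Sorted≤ ∘ toList) E → All Sorted≤ (proj₁ (splitZeroColumns E))
zeroColumnTails-Sorted≤ []                _            = []
zeroColumnTails-Sorted≤ ((zero ∷ _) ∷ E)  (col ∷ cols) = Linked.tail col ∷ zeroColumnTails-Sorted≤ E cols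
zeroColumnTails-Sorted≤ ((suc _ ∷ _) ∷ _) _            = []

-- After deleting the least symbol: the number x of ordinary columns it headed, its multiplicity in
-- each headless column, and what remains.
Peeled : ℕ → Set
Peeled n = ℕ × List ℕ × Partial n

module Lps where
  open Tableaux F._<_ F._≤_ ℕP.<-irrelevant ℕP.≤-irrelevant public

  columns⁻ : ∀ {n} (X : List (List (Fin n))) (E : Filling n) →
    All (Sorted< ∘ toList) (zeroColumns (map (map suc) X) ++ map liftColumn E) → All Sorted< X × All (Sorted< ∘ toList) E
  columns⁻ X E cols =
    All.map (Sorted<-map-suc⁻ ∘ Linked.tail) (Allₚ.map⁻ (Allₚ.map⁻ (proj₁ halves))) ,
    All.map Sorted<-map-suc⁻ (Allₚ.map⁻ (proj₂ halves))
    where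
    halves : All (Sorted< ∘ toList) (zeroColumns (map (map suc) X)) × All (Sorted< ∘ toList) (map liftColumn E)
    halves = Allₚ.++⁻ (zeroColumns (map (map suc) X)) cols

  columns⁺ : ∀ {n} (X : List (List (Fin n))) (E : Filling n) →
    All Sorted< X → All (Sorted< ∘ toList) E → All (Sorted< ∘ toList) (zeroColumns (map (map suc) X) ++ map liftColumn E)
  columns⁺ X E colsX colsE =
    Allₚ.++⁺ (Allₚ.map⁺ (Allₚ.map⁺ (All.map (Sorted<-zero∷map-suc⁺ _) colsX)))
             (Allₚ.map⁺ (All.map Sorted<-map-suc⁺ colsE))

  rebuild : ∀ {n} → List ℕ → List (List (Fin n)) → List (List (Fin n)) → Filling n → Partial (suc n)
  rebuild ts L X E = zipWith raise ts L , zeroColumns (map (map suc) X) ++ map liftColumn E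

  zeros-rebuild : ∀ {n} ts (L X : List (List (Fin n))) E → length ts ≡ length L →
    zeros (partialEntries (rebuild ts L X E)) ≡ sum ts + length X
  zeros-rebuild {n} ts L X E len = begin
    zeros (partialEntries (rebuild ts L X E))
      ≡⟨ zeros-partialEntries P Y E ⟩
    zeros (concat (P ++ Y)) + length Y
      ≡⟨ cong₂ _+_ (cong zeros (sym (Listₚ.concat-++ P Y))) (Listₚ.length-map (map suc) X) ⟩
    zeros (concat P ++ concat Y) + length X
      ≡⟨ cong (_+ length X) (zeros-++ (concat P) (concat Y)) ⟩
    zeros (concat P) + zeros (concat Y) + length X
      ≡⟨ cong (λ z → z + zeros (concat Y) + length X) (trans (zeros-concat P) (cong sum (map-zeros-zipWith-raise ts L len))) ⟩
    sum ts + zeros (concat Y) + length X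
      ≡⟨ cong (λ z → sum ts + z + length X) (trans (cong zeros (Listₚ.concat-map X)) (zeros-map-suc (concat X))) ⟩
    sum ts + 0 + length X
      ≡⟨ cong (_+ length X) (ℕP.+-identityʳ (sum ts)) ⟩
    sum ts + length X ∎
    where
    open ≡-Reasoning
    P Y : List (List (Fin (suc n)))
    P = zipWith raise ts L
    Y = map (map suc) X

  lower-rebuild : ∀ {n} ts (L X : List (List (Fin n))) E → length ts ≡ length L →
    lower (partialEntries (rebuild ts L X E)) ≡ partialEntries (L ++ X , E)
  lower-rebuild {n} ts L X E len = begin
    lower (partialEntries (rebuild ts L X E))
      ≡⟨ lower-partialEntries P Y E ⟩
    lower (concat (P ++ Y)) ++ entries E
      ≡⟨ cong (λ z → lower z ++ entries E) (sym (Listₚ.concat-++ P Y)) ⟩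
    lower (concat P ++ concat Y) ++ entries E
      ≡⟨ cong (_++ entries E) (lower-++ (concat P) (concat Y)) ⟩
    (lower (concat P) ++ lower (concat Y)) ++ entries E
      ≡⟨ cong₂ (λ u v → (u ++ v) ++ entries E)
           (trans (lower-concat P) (cong concat (map-lower-zipWith-raise ts L len)))
           (trans (cong lower (Listₚ.concat-map X)) (lower-map-suc (concat X))) ⟩
    (concat L ++ concat X) ++ entries E
      ≡⟨ cong (_++ entries E) (Listₚ.concat-++ L X) ⟩
    partialEntries (L ++ X , E) ∎
    where
    open ≡-Reasoning
    P Y : List (List (Fin (suc n)))
    P = zipWith raise ts L
    Y = map (map suc) X

  Valid-rebuild⁻ : ∀ {n} m ts (L X : List (List (Fin n))) E → length ts ≡ length L →
    Valid (suc n) m (rebuild ts L X E) →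
    All (ℕ._≤ 1) ts × sum ts + length X ≡ m zero × Valid n (m ∘ suc) (L ++ X , E)
  Valid-rebuild⁻ m ts L X E len (colsB , colsE , bot , zeros≡ , content) =
    proj₁ splitB , trans (sym (zeros-rebuild ts L X E len)) zeros≡ ,
    Allₚ.++⁺ (proj₂ splitB) (proj₁ splitE) , proj₂ splitE ,
    Sorted≤-raise⁻ (length (map (map suc) X)) (subst Sorted≤ (bottomRow-zeroColumns-++ (map (map suc) X) E) bot) ,
    subst (λ l → Content _ l _) (lower-rebuild ts L X E len) content
    where
    splitB : All (ℕ._≤ 1) ts × All Sorted< L
    splitB = All-Sorted<-zipWith-raise⁻ ts L len colsB
    splitE : All Sorted< X × All (Sorted< ∘ toList) E
    splitE = columns⁻ X E colsE

  Valid-rebuild⁺ : ∀ {n} m ts (L X : List (List (Fin n))) E → length ts ≡ length L →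
    All (ℕ._≤ 1) ts → sum ts + length X ≡ m zero → Valid n (m ∘ suc) (L ++ X , E) →
    Valid (suc n) m (rebuild ts L X E)
  Valid-rebuild⁺ m ts L X E len ts≤1 sum≡ (colsLX , colsE , bot , content) =
    All-Sorted<-zipWith-raise⁺ ts L len ts≤1 (proj₁ splitLX) , columns⁺ X E (proj₂ splitLX) colsE ,
    subst Sorted≤ (sym (bottomRow-zeroColumns-++ (map (map suc) X) E)) (Sorted≤-raise⁺ _ bot) ,
    trans (zeros-rebuild ts L X E len) sum≡ ,
    subst (λ l → Content _ l _) (sym (lower-rebuild ts L X E len)) content
    where
    splitLX : All Sorted< L × All Sorted< X
    splitLX = Allₚ.++⁻ L colsLX

  collect : ∀ {n} → List (List (Fin (suc n))) → List (List (Fin (suc n))) × Filling (suc n) → Peeled n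
  collect B (Z , R) = length Z , map zeros B , (map lower B ++ map lower Z , lowerFilling R)

  peel : ∀ {n} → Partial (suc n) → Peeled n
  peel (B , E) = collect B (splitZeroColumns E)

  unpeel : ∀ {n} → ℕ → Peeled n → Partial (suc n)
  unpeel c (x , ts , (B′ , E′)) = rebuild ts (take c B′) (drop c B′) E′

  IsPeeled : ∀ n → ℕ → (Fin (suc n) → ℕ) → Peeled n → Set
  IsPeeled n c m (x , ts , r) = x ℕ.≤ m zero × IsBinaryWord c (m zero ∸ x) ts × IsPartialTableau n (c + x) (m ∘ suc) r

  IsPeeled-irrelevant : ∀ n c m t → Irrelevant (IsPeeled n c m t)
  IsPeeled-irrelevant n c m (x , ts , r) =
    ×-irrelevant ℕP.≤-irrelevant (×-irrelevant (IsBinaryWord-irrelevant c _ ts) (IsPartialTableau-irrelevant n _ _ r))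

  unpeel-isPeeled : ∀ {n} c m x ts (B′ : List (List (Fin n))) E′ → length ts ≡ c → length B′ ≡ c + x →
    Valid (suc n) m (unpeel c (x , ts , (B′ , E′))) → IsPeeled n c m (x , ts , (B′ , E′))
  unpeel-isPeeled {n} c m x ts B′ E′ lenTs lenB valid =
    m+n≡o⇒n≤o (sum ts) sum≡ , ((lenTs , m+n≡o⇒m≡o∸n (sum ts) x sum≡) , proj₁ peeled) ,
    lenB , subst (λ B → Valid n _ (B , E′)) (Listₚ.take++drop≡id c B′) (proj₂ (proj₂ peeled))
    where
    peeled : All (ℕ._≤ 1) ts × sum ts + length (drop c B′) ≡ m zero × Valid n (m ∘ suc) (take c B′ ++ drop c B′ , E′)
    peeled = Valid-rebuild⁻ m ts (take c B′) (drop c B′) E′ (trans lenTs (sym (length-take-+ c x B′ lenB))) valid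
    sum≡ : sum ts + x ≡ m zero
    sum≡ = trans (cong (sum ts +_) (sym (length-drop-+ c x B′ lenB))) (proj₁ (proj₂ peeled))

  unpeel-isPartialTableau : ∀ {n} c m (t : Peeled n) → IsPeeled n c m t → IsPartialTableau (suc n) c m (unpeel c t)
  unpeel-isPartialTableau c m (x , ts , (B′ , E′)) (x≤ , ((lenTs , sum≡) , ts≤1) , lenB , valid) =
    trans (length-zipWith-≡ raise ts (take c B′) lenTs′) lenTs ,
    Valid-rebuild⁺ m ts (take c B′) (drop c B′) E′ lenTs′ ts≤1
      (trans (cong (sum ts +_) (length-drop-+ c x B′ lenB)) (m≡o∸n⇒m+n≡o x≤ sum≡))
      (subst (λ B → Valid _ _ (B , E′)) (sym (Listₚ.take++drop≡id c B′)) valid)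
    where
    lenTs′ : length ts ≡ length (take c B′)
    lenTs′ = trans lenTs (sym (length-take-+ c x B′ lenB))

  unpeel∘peel : ∀ {n} c m (r : Partial (suc n)) → IsPartialTableau (suc n) c m r → unpeel c (peel r) ≡ r
  unpeel∘peel {n} c m (B , E) (len , colsB , colsE , bot , _) = cong₂ _,_
    (trans (cong (zipWith raise (map zeros B)) (take-++ (map lower B) _ lenLB))
           (zipWith-raise-zeros-lower B (All.map Sorted<⇒Sorted≤ colsB)))
    (trans (cong (λ X → zeroColumns (map (map suc) X) ++ map liftColumn (lowerFilling R)) (drop-++ (map lower B) _ lenLB))
    (trans (cong (λ Y → zeroColumns Y ++ map liftColumn (lowerFilling R)) (map-map-suc-lower-zeroColumnTails E colsE))
           (splitZeroColumns-inverse E (All.map Sorted<⇒Sorted≤ colsE) bot)))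
    where
    R : Filling (suc n)
    R = proj₂ (splitZeroColumns E)
    lenLB : length (map lower B) ≡ c
    lenLB = trans (Listₚ.length-map lower B) len

  peel∘unpeel : ∀ {n} c m (t : Peeled n) → IsPeeled n c m t → peel (unpeel c t) ≡ t
  peel∘unpeel {n} c m (x , ts , (B′ , E′)) (_ , ((lenTs , _) , _) , lenB , _) = begin
    collect P (splitZeroColumns (zeroColumns Y ++ map liftColumn E′))
      ≡⟨ cong (collect P) (splitZeroColumns-++ Y E′) ⟩
    length Y , map zeros P , (map lower P ++ map lower Y , lowerFilling (map liftColumn E′))
      ≡⟨ cong₂ _,_ (trans (Listₚ.length-map (map suc) X) (length-drop-+ c x B′ lenB))
           (cong₂ _,_ (map-zeros-zipWith-raise ts L lenTsL)
             (cong₂ _,_ (trans (cong₂ _++_ (map-lower-zipWith-raise ts L lenTsL) (map-lower-map-map-suc X))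
                               (Listₚ.take++drop≡id c B′))
                        (lowerFilling-map-liftColumn E′))) ⟩
    x , ts , (B′ , E′) ∎
    where
    open ≡-Reasoning
    L X : List (List (Fin n))
    L = take c B′
    X = drop c B′
    P Y : List (List (Fin (suc n)))
    P = zipWith raise ts L
    Y = map (map suc) X
    lenTsL : length ts ≡ length L
    lenTsL = trans lenTs (sym (length-take-+ c x B′ lenB))

  peel-↔ : ∀ n c m → PartialTableau (suc n) c m ↔ Σ (Peeled n) (IsPeeled n c m)
  peel-↔ n c m = Σ-restrict-↔ peel (unpeel c) isPeeled (unpeel-isPartialTableau c m)
    (unpeel∘peel c m) (peel∘unpeel c m) (IsPartialTableau-irrelevant (suc n) c m) (IsPeeled-irrelevant n c m)
    where
    isPeeled : ∀ r → IsPartialTableau (suc n) c m r → IsPeeled n c m (peel r)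
    isPeeled (B , E) p@(len , valid) = unpeel-isPeeled c m (length Z) (map zeros B) _ _
      (trans (Listₚ.length-map zeros B) len)
      (trans (Listₚ.length-++ (map lower B)) (cong₂ _+_ (trans (Listₚ.length-map lower B) len) (Listₚ.length-map lower Z)))
      (subst (Valid (suc n) m) (sym (unpeel∘peel c m (B , E) p)) valid)
      where
      Z = proj₁ (splitZeroColumns E)

  peeled-↔ : ∀ n c m → Σ (Peeled n) (IsPeeled n c m) ↔
    Σ ℕ (λ x → x ℕ.≤ m zero × (BinaryWord c (m zero ∸ x) × PartialTableau n (c + x) (m ∘ suc)))
  peeled-↔ n c m = mk↔ₛ′ (λ ((x , ts , r) , x≤ , w , p) → x , x≤ , (ts , w) , (r , p))
    (λ (x , x≤ , (ts , w) , (r , p)) → (x , ts , r) , x≤ , w , p) (λ _ → refl) (λ _ → refl)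

  -- c C (m₁ − x) chooses the headless columns whose bottom entry is the least symbol.
  count : ∀ n → ℕ → (Fin n → ℕ) → ℕ
  count zero    c m = 1
  count (suc n) c m = sumFin (suc (m zero)) (λ i → (c C (m zero ∸ toℕ i)) * count n (c + toℕ i) (m ∘ suc))

  partialTableau-↔-Fin : ∀ n c m → PartialTableau n c m ↔ Fin (count n c m)
  partialTableau-↔-Fin zero    c m = partialTableau₀-↔-Fin1 c m
  partialTableau-↔-Fin (suc n) c m =
    ↔-trans (peel-↔ n c m) (↔-trans (peeled-↔ n c m)
    (↔-trans (bounded-↔-Fin _ (m zero))
    (Σ-↔-sumFin (suc (m zero)) _ (λ i → ×-↔-Fin (binaryWord-↔-Fin c _) (partialTableau-↔-Fin n (c + toℕ i) (m ∘ suc))))))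

module Rps where
  open Tableaux F._≤_ F._<_ ℕP.≤-irrelevant ℕP.<-irrelevant public

  columns⁻ : ∀ {n} (Y : List (List (Fin (suc n)))) (E : Filling n) →
    All (Sorted≤ ∘ toList) (zeroColumns Y ++ map liftColumn E) → All Sorted≤ Y × All (Sorted≤ ∘ toList) E
  columns⁻ Y E cols =
    All.map Linked.tail (Allₚ.map⁻ (proj₁ halves)) , All.map Sorted≤-map-suc⁻ (Allₚ.map⁻ (proj₂ halves))
    where
    halves : All (Sorted≤ ∘ toList) (zeroColumns Y) × All (Sorted≤ ∘ toList) (map liftColumn E)
    halves = Allₚ.++⁻ (zeroColumns Y) cols

  columns⁺ : ∀ {n} (Y : List (List (Fin (suc n)))) (E : Filling n) →
    All Sorted≤ Y → All (Sorted≤ ∘ toList) E → All (Sorted≤ ∘ toList) (zeroColumns Y ++ map liftColumn E)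
  columns⁺ Y E colsY colsE =
    Allₚ.++⁺ (Allₚ.map⁺ (All.map Sorted≤-zero∷⁺ colsY)) (Allₚ.map⁺ (All.map Sorted≤-map-suc⁺ colsE))

  rebuild : ∀ {n} → ℕ → List (List (Fin (suc n))) → Filling n → Partial (suc n)
  rebuild c B E = take c B , zeroColumns (drop c B) ++ map liftColumn E

  zeros-rebuild : ∀ {n} c ts (L : List (List (Fin n))) E → length ts ≡ length L →
    zeros (partialEntries (rebuild c (zipWith raise ts L) E)) ≡ sum ts + length (drop c (zipWith raise ts L))
  zeros-rebuild {n} c ts L E len = begin
    zeros (partialEntries (rebuild c P E))
      ≡⟨ zeros-partialEntries (take c P) (drop c P) E ⟩
    zeros (concat (take c P ++ drop c P)) + length (drop c P)
      ≡⟨ cong (λ B → zeros (concat B) + length (drop c P)) (Listₚ.take++drop≡id c P) ⟩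
    zeros (concat P) + length (drop c P)
      ≡⟨ cong (_+ length (drop c P)) (trans (zeros-concat P) (cong sum (map-zeros-zipWith-raise ts L len))) ⟩
    sum ts + length (drop c P) ∎
    where
    open ≡-Reasoning
    P : List (List (Fin (suc n)))
    P = zipWith raise ts L

  lower-rebuild : ∀ {n} c ts (L : List (List (Fin n))) E → length ts ≡ length L →
    lower (partialEntries (rebuild c (zipWith raise ts L) E)) ≡ partialEntries (L , E)
  lower-rebuild {n} c ts L E len = begin
    lower (partialEntries (rebuild c P E))
      ≡⟨ lower-partialEntries (take c P) (drop c P) E ⟩
    lower (concat (take c P ++ drop c P)) ++ entries E
      ≡⟨ cong (λ B → lower (concat B) ++ entries E) (Listₚ.take++drop≡id c P) ⟩
    lower (concat P) ++ entries E
      ≡⟨ cong (_++ entries E) (trans (lower-concat P) (cong concat (map-lower-zipWith-raise ts L len))) ⟩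
    partialEntries (L , E) ∎
    where
    open ≡-Reasoning
    P : List (List (Fin (suc n)))
    P = zipWith raise ts L

  Valid-rebuild⁻ : ∀ {n} c x m ts (L : List (List (Fin n))) E → length ts ≡ length L → length L ≡ c + x →
    Valid (suc n) m (rebuild c (zipWith raise ts L) E) → x ℕ.≤ 1 × sum ts + x ≡ m zero × Valid n (m ∘ suc) (L , E)
  Valid-rebuild⁻ {n} c x m ts L E len lenL (colsP , colsE , bot , zeros≡ , content) =
    subst (ℕ._≤ 1) lenY (proj₁ botE) ,
    trans (cong (sum ts +_) (sym lenY)) (trans (sym (zeros-rebuild c ts L E len)) zeros≡) ,
    All-Sorted≤-zipWith-raise⁻ ts L len
      (subst (All Sorted≤) (Listₚ.take++drop≡id c P) (Allₚ.++⁺ colsP (proj₁ colsYE))) ,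
    proj₂ colsYE , proj₂ botE ,
    subst (λ l → Content _ l _) (lower-rebuild c ts L E len) content
    where
    P : List (List (Fin (suc n)))
    P = zipWith raise ts L
    lenY : length (drop c P) ≡ x
    lenY = length-drop-+ c x P (trans (length-zipWith-≡ raise ts L len) (trans len lenL))
    colsYE : All Sorted≤ (drop c P) × All (Sorted≤ ∘ toList) E
    colsYE = columns⁻ (drop c P) E colsE
    botE : length (drop c P) ℕ.≤ 1 × Sorted< (bottomRow E)
    botE = Sorted<-raise⁻ _ (bottomRow E) (subst Sorted< (bottomRow-zeroColumns-++ (drop c P) E) bot)

  Valid-rebuild⁺ : ∀ {n} c x m ts (L : List (List (Fin n))) E → length ts ≡ length L → length L ≡ c + x →
    x ℕ.≤ 1 → sum ts + x ≡ m zero → Valid n (m ∘ suc) (L , E) → Valid (suc n) m (rebuild c (zipWith raise ts L) E)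
  Valid-rebuild⁺ {n} c x m ts L E len lenL x≤1 sum≡ (colsL , colsE , bot , content) =
    proj₁ colsPY , columns⁺ (drop c P) E (proj₂ colsPY) colsE ,
    subst Sorted< (sym (bottomRow-zeroColumns-++ (drop c P) E)) (Sorted<-raise⁺ _ _ (subst (ℕ._≤ 1) (sym lenY) x≤1) bot) ,
    trans (zeros-rebuild c ts L E len) (trans (cong (sum ts +_) lenY) sum≡) ,
    subst (λ l → Content _ l _) (sym (lower-rebuild c ts L E len)) content
    where
    P : List (List (Fin (suc n)))
    P = zipWith raise ts L
    lenY : length (drop c P) ≡ x
    lenY = length-drop-+ c x P (trans (length-zipWith-≡ raise ts L len) (trans len lenL))
    colsPY : All Sorted≤ (take c P) × All Sorted≤ (drop c P)
    colsPY = Allₚ.++⁻ (take c P)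
      (subst (All Sorted≤) (sym (Listₚ.take++drop≡id c P)) (All-Sorted≤-zipWith-raise⁺ ts L len colsL))

  collect : ∀ {n} → List (List (Fin (suc n))) → List (List (Fin (suc n))) × Filling (suc n) → Peeled n
  collect B (Z , R) = length Z , map zeros (B ++ Z) , (map lower (B ++ Z) , lowerFilling R)

  peel : ∀ {n} → Partial (suc n) → Peeled n
  peel (B , E) = collect B (splitZeroColumns E)

  unpeel : ∀ {n} → ℕ → Peeled n → Partial (suc n)
  unpeel c (x , ts , (B′ , E′)) = rebuild c (zipWith raise ts B′) E′

  IsPeeled : ∀ n → ℕ → (Fin (suc n) → ℕ) → Peeled n → Set
  IsPeeled n c m (x , ts , r) =
    x ℕ.≤ 1 × x ℕ.≤ m zero × IsWeakComposition (c + x) (m zero ∸ x) ts × IsPartialTableau n (c + x) (m ∘ suc) r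

  IsPeeled-irrelevant : ∀ n c m t → Irrelevant (IsPeeled n c m t)
  IsPeeled-irrelevant n c m (x , ts , r) = ×-irrelevant ℕP.≤-irrelevant (×-irrelevant ℕP.≤-irrelevant
    (×-irrelevant (IsWeakComposition-irrelevant _ _ ts) (IsPartialTableau-irrelevant n _ _ r)))

  unpeel∘peel : ∀ {n} c m (r : Partial (suc n)) → IsPartialTableau (suc n) c m r → unpeel c (peel r) ≡ r
  unpeel∘peel {n} c m (B , E) (len , colsB , colsE , bot , _) = begin
    rebuild c (zipWith raise (map zeros (B ++ Z)) (map lower (B ++ Z))) (lowerFilling R)
      ≡⟨ cong (λ B′ → rebuild c B′ (lowerFilling R))
           (zipWith-raise-zeros-lower (B ++ Z) (Allₚ.++⁺ colsB (zeroColumnTails-Sorted≤ E colsE))) ⟩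
    take c (B ++ Z) , zeroColumns (drop c (B ++ Z)) ++ map liftColumn (lowerFilling R)
      ≡⟨ cong₂ _,_ (take-++ B Z len)
           (trans (cong (λ Y → zeroColumns Y ++ map liftColumn (lowerFilling R)) (drop-++ B Z len))
                  (splitZeroColumns-inverse E colsE (Sorted<⇒Sorted≤ bot))) ⟩
    B , E ∎
    where
    open ≡-Reasoning
    Z : List (List (Fin (suc n)))
    Z = proj₁ (splitZeroColumns E)
    R : Filling (suc n)
    R = proj₂ (splitZeroColumns E)

  peel∘unpeel : ∀ {n} c m (t : Peeled n) → IsPeeled n c m t → peel (unpeel c t) ≡ t
  peel∘unpeel {n} c m (x , ts , (B′ , E′)) (_ , _ , (lenTs , _) , lenB , _) = begin
    collect (take c P) (splitZeroColumns (zeroColumns (drop c P) ++ map liftColumn E′))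
      ≡⟨ cong (collect (take c P)) (splitZeroColumns-++ (drop c P) E′) ⟩
    length (drop c P) , map zeros (take c P ++ drop c P) , (map lower (take c P ++ drop c P) , lowerFilling (map liftColumn E′))
      ≡⟨ cong (λ Q → length (drop c P) , map zeros Q , (map lower Q , lowerFilling (map liftColumn E′)))
              (Listₚ.take++drop≡id c P) ⟩
    length (drop c P) , map zeros P , (map lower P , lowerFilling (map liftColumn E′))
      ≡⟨ cong₂ _,_ (length-drop-+ c x P (trans (length-zipWith-≡ raise ts B′ len) lenTs))
           (cong₂ _,_ (map-zeros-zipWith-raise ts B′ len)
                      (cong₂ _,_ (map-lower-zipWith-raise ts B′ len) (lowerFilling-map-liftColumn E′))) ⟩
    x , ts , (B′ , E′) ∎
    where
    open ≡-Reasoning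
    P : List (List (Fin (suc n)))
    P = zipWith raise ts B′
    len : length ts ≡ length B′
    len = trans lenTs (sym lenB)

  unpeel-isPeeled : ∀ {n} c m x ts (B′ : List (List (Fin n))) E′ → length ts ≡ c + x → length B′ ≡ c + x →
    Valid (suc n) m (unpeel c (x , ts , (B′ , E′))) → IsPeeled n c m (x , ts , (B′ , E′))
  unpeel-isPeeled {n} c m x ts B′ E′ lenTs lenB valid =
    proj₁ peeled , m+n≡o⇒n≤o (sum ts) sum≡ , (lenTs , m+n≡o⇒m≡o∸n (sum ts) x sum≡) , lenB , proj₂ (proj₂ peeled)
    where
    peeled : x ℕ.≤ 1 × sum ts + x ≡ m zero × Valid n (m ∘ suc) (B′ , E′)
    peeled = Valid-rebuild⁻ c x m ts B′ E′ (trans lenTs (sym lenB)) lenB valid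
    sum≡ : sum ts + x ≡ m zero
    sum≡ = proj₁ (proj₂ peeled)

  unpeel-isPartialTableau : ∀ {n} c m (t : Peeled n) → IsPeeled n c m t → IsPartialTableau (suc n) c m (unpeel c t)
  unpeel-isPartialTableau c m (x , ts , (B′ , E′)) (x≤1 , x≤ , (lenTs , sum≡) , lenB , valid) =
    length-take-+ c x (zipWith raise ts B′) (trans (length-zipWith-≡ raise ts B′ len) lenTs) ,
    Valid-rebuild⁺ c x m ts B′ E′ len lenB x≤1 (m≡o∸n⇒m+n≡o x≤ sum≡) valid
    where
    len : length ts ≡ length B′
    len = trans lenTs (sym lenB)

  peel-↔ : ∀ n c m → PartialTableau (suc n) c m ↔ Σ (Peeled n) (IsPeeled n c m)
  peel-↔ n c m = Σ-restrict-↔ peel (unpeel c) isPeeled (unpeel-isPartialTableau c m)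
    (unpeel∘peel c m) (peel∘unpeel c m) (IsPartialTableau-irrelevant (suc n) c m) (IsPeeled-irrelevant n c m)
    where
    isPeeled : ∀ r → IsPartialTableau (suc n) c m r → IsPeeled n c m (peel r)
    isPeeled (B , E) p@(len , valid) =
      unpeel-isPeeled c m (length Z) (map zeros (B ++ Z)) (map lower (B ++ Z)) _ lenTs lenL
        (subst (Valid (suc n) m) (sym (unpeel∘peel c m (B , E) p)) valid)
      where
      Z : List (List (Fin (suc n)))
      Z = proj₁ (splitZeroColumns E)
      lenL : length (map lower (B ++ Z)) ≡ c + length Z
      lenL = trans (Listₚ.length-map lower (B ++ Z)) (trans (Listₚ.length-++ B) (cong (_+ length Z) len))
      lenTs : length (map zeros (B ++ Z)) ≡ c + length Z
      lenTs = trans (Listₚ.length-map zeros (B ++ Z)) (trans (sym (Listₚ.length-map lower (B ++ Z))) lenL)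

  peeled-↔ : ∀ n c m → Σ (Peeled n) (IsPeeled n c m) ↔
    Σ ℕ (λ x → x ℕ.≤ 1 × (x ℕ.≤ m zero × (WeakComposition (c + x) (m zero ∸ x) × PartialTableau n (c + x) (m ∘ suc))))
  peeled-↔ n c m = mk↔ₛ′ (λ ((x , ts , r) , x≤1 , x≤ , w , p) → x , x≤1 , x≤ , (ts , w) , (r , p))
    (λ (x , x≤1 , x≤ , (ts , w) , (r , p)) → (x , ts , r) , x≤1 , x≤ , w , p) (λ _ → refl) (λ _ → refl)

  -- The occurrences of the least symbol fill the c + x headless columns as a weak composition.
  count : ∀ n → ℕ → (Fin n → ℕ) → ℕ
  count zero    c m = 1
  count (suc n) c m = sumFin 2 (λ i → multichoose (c + toℕ i) (m zero ∸ toℕ i) * count n (c + toℕ i) (m ∘ suc))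

  partialTableau-↔-Fin : ∀ n c m → (∀ a → 0 ℕ.< m a) → PartialTableau n c m ↔ Fin (count n c m)
  partialTableau-↔-Fin zero    c m _   = partialTableau₀-↔-Fin1 c m
  partialTableau-↔-Fin (suc n) c m pos =
    ↔-trans (peel-↔ n c m) (↔-trans (peeled-↔ n c m) (↔-trans (bounded-↔-Fin _ 1)
    (Σ-↔-sumFin 2 _ λ i → ↔-trans (inhabited-irrelevant-×-↔ (i≤m i) ℕP.≤-irrelevant)
      (×-↔-Fin (weakComposition-↔-Fin (c + toℕ i) _) (partialTableau-↔-Fin n (c + toℕ i) (m ∘ suc) (pos ∘ suc))))))
    where
    -- Only here is positivity needed: it makes the constraint x ≤ m₁ redundant once x ≤ 1.
    i≤m : (i : Fin 2) → toℕ i ℕ.≤ m zero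
    i≤m i = ℕP.≤-trans (ℕP.≤-pred (FP.toℕ<n i)) (pos zero)

-- The closed formulas

sum-concatMap : {A B : Set} (f : B → ℕ) (g : A → List B) (xs : List A) →
  sum (map f (concatMap g xs)) ≡ sum (map (λ x → sum (map f (g x))) xs)
sum-concatMap f g []       = refl
sum-concatMap f g (x ∷ xs) = begin
  sum (map f (g x ++ concatMap g xs))        ≡⟨ cong sum (Listₚ.map-++ f (g x) _) ⟩
  sum (map f (g x) ++ map f (concatMap g xs)) ≡⟨ sum-++ (map f (g x)) _ ⟩
  sum (map f (g x)) + sum (map f (concatMap g xs))      ≡⟨ cong (sum (map f (g x)) +_) (sum-concatMap f g xs) ⟩
  sum (map f (g x)) + sum (map (λ x → sum (map f (g x))) xs) ∎
  where open ≡-Reasoning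

sum-map-*ˡ : {A : Set} (a : ℕ) (f : A → ℕ) (xs : List A) → sum (map (λ y → a * f y) xs) ≡ a * sum (map f xs)
sum-map-*ˡ a f []       = sym (ℕP.*-zeroʳ a)
sum-map-*ˡ a f (y ∷ xs) = trans (cong (a * f y +_) (sum-map-*ˡ a f xs)) (sym (ℕP.*-distribˡ-+ a (f y) _))

sum-map-cong : {A : Set} {f g : A → ℕ} → (∀ y → f y ≡ g y) → (xs : List A) → sum (map f xs) ≡ sum (map g xs)
sum-map-cong f≗g xs = cong sum (Listₚ.map-cong f≗g xs)

sum-applyUpTo : ∀ (f g : ℕ → ℕ) r → sum (map f (applyUpTo g r)) ≡ sumFin r (f ∘ g ∘ toℕ)
sum-applyUpTo f g zero    = refl
sum-applyUpTo f g (suc r) = cong (f (g 0) +_) (sum-applyUpTo f (g ∘ suc) r)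

sumFin-cong : ∀ r {f g : Fin r → ℕ} → (∀ i → f i ≡ g i) → sumFin r f ≡ sumFin r g
sumFin-cong zero    _   = refl
sumFin-cong (suc r) f≗g = cong₂ _+_ (f≗g zero) (sumFin-cong r (f≗g ∘ suc))

allFin-suc : ∀ k → allFin (suc k) ≡ zero ∷ map suc (allFin k)
allFin-suc k = cong (zero ∷_) (sym (Listₚ.map-tabulate id suc))

product-allFin-suc : ∀ k (h : Fin (suc k) → ℕ) → product (map h (allFin (suc k))) ≡ h zero * product (map (h ∘ suc) (allFin k))
product-allFin-suc k h =
  trans (cong (product ∘ map h) (allFin-suc k)) (cong (h zero *_) (cong product (sym (Listₚ.map-∘ (allFin k)))))

filter-<?-zero : ∀ {k} (xs : List (Fin (suc k))) → filter (_<? zero {k}) xs ≡ []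
filter-<?-zero []       = refl
filter-<?-zero (_ ∷ xs) = filter-<?-zero xs

filter-<?-suc : ∀ {k} (a : Fin k) (xs : List (Fin k)) → filter (_<? suc a) (map suc xs) ≡ map suc (filter (_<? a) xs)
filter-<?-suc a []       = refl
filter-<?-suc a (y ∷ xs) with y <? a
... | yes y<a = trans (Listₚ.filter-accept (_<? suc a) (s≤s y<a))
  (trans (cong (suc y ∷_) (filter-<?-suc a xs)) (cong (map suc) (sym (Listₚ.filter-accept (_<? a) y<a))))
... | no  y≮a = trans (Listₚ.filter-reject (_<? suc a) (y≮a ∘ ℕ.s≤s⁻¹))
  (trans (filter-<?-suc a xs) (cong (map suc) (sym (Listₚ.filter-reject (_<? a) y≮a))))

prefixSum-zero : ∀ {k} x (j : Vec ℕ k) → prefixSum (x ∷ j) zero ≡ 0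
prefixSum-zero {k} x j = cong (sum ∘ map (lookup (x ∷ j))) (filter-<?-zero (allFin (suc k)))

prefixSum-suc : ∀ {k} x (j : Vec ℕ k) a → prefixSum (x ∷ j) (suc a) ≡ x + prefixSum j a
prefixSum-suc {k} x j a = begin
  sum (map (lookup (x ∷ j)) (filter (_<? suc a) (allFin (suc k))))
    ≡⟨ cong (λ l → sum (map (lookup (x ∷ j)) (filter (_<? suc a) l))) (allFin-suc k) ⟩
  x + sum (map (lookup (x ∷ j)) (filter (_<? suc a) (map suc (allFin k))))
    ≡⟨ cong (λ l → x + sum (map (lookup (x ∷ j)) l)) (filter-<?-suc a (allFin k)) ⟩
  x + sum (map (lookup (x ∷ j)) (map suc (filter (_<? a) (allFin k))))
    ≡⟨ cong (λ l → x + sum l) (sym (Listₚ.map-∘ (filter (_<? a) (allFin k)))) ⟩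
  x + prefixSum j a ∎
  where open ≡-Reasoning

-- Lformula and Rformula are instances of boxFormula up to definitional unfolding.
boxFormula : ∀ k → (Fin k → ℕ) → (Fin k → ℕ → ℕ → ℕ) → ℕ
boxFormula k b h = sum (map (λ j → product (map (λ a → h a (prefixSum j a) (lookup j a)) (allFin k))) (box k b))

boxFormula-cong : ∀ k b {h h′ : Fin k → ℕ → ℕ → ℕ} → (∀ a p v → h a p v ≡ h′ a p v) → boxFormula k b h ≡ boxFormula k b h′
boxFormula-cong k b h≗h′ = sum-map-cong (λ j → cong product (Listₚ.map-cong (λ a → h≗h′ a _ _) (allFin k))) (box k b)

product-prefixSum-∷ : ∀ k (h : Fin (suc k) → ℕ → ℕ → ℕ) x (j : Vec ℕ k) →
  product (map (λ a → h a (prefixSum (x ∷ j) a) (lookup (x ∷ j) a)) (allFin (suc k)))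
  ≡ h zero 0 x * product (map (λ a → h (suc a) (x + prefixSum j a) (lookup j a)) (allFin k))
product-prefixSum-∷ k h x j =
  trans (product-allFin-suc k (λ a → h a (prefixSum (x ∷ j) a) (lookup (x ∷ j) a)))
        (cong₂ _*_ (cong (λ p → h zero p x) (prefixSum-zero x j))
                   (cong product (Listₚ.map-cong (λ a → cong (λ p → h (suc a) p (lookup j a)) (prefixSum-suc x j a)) (allFin k))))

boxFormula-suc : ∀ k b (h : Fin (suc k) → ℕ → ℕ → ℕ) →
  boxFormula (suc k) b h ≡ sum (map (λ x → h zero 0 x * boxFormula k (b ∘ suc) (λ a p → h (suc a) (x + p))) (upTo (suc (b zero))))
boxFormula-suc k b h = trans (sum-concatMap _ (λ x → map (x ∷_) (box k (b ∘ suc))) (upTo (suc (b zero))))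
  (sum-map-cong (λ x → trans (cong sum (sym (Listₚ.map-∘ (box k (b ∘ suc)))))
    (trans (sum-map-cong (product-prefixSum-∷ k h x) (box k (b ∘ suc)))
           (sum-map-*ˡ (h zero 0 x) _ (box k (b ∘ suc))))) (upTo (suc (b zero))))

lpsFormula : ∀ k → ℕ → (Fin k → ℕ) → ℕ
lpsFormula k c m = boxFormula k m (λ a p v → (c + p) C (m a ∸ v))

lpsFormula≡count : ∀ k c m → lpsFormula k c m ≡ Lps.count k c m
lpsFormula≡count zero    c m = refl
lpsFormula≡count (suc k) c m = begin
  lpsFormula (suc k) c m
    ≡⟨ boxFormula-suc k m (λ a p v → (c + p) C (m a ∸ v)) ⟩
  sum (map (λ x → ((c + 0) C (m zero ∸ x)) * boxFormula k (m ∘ suc) (λ a p v → (c + (x + p)) C (m (suc a) ∸ v)))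
           (upTo (suc (m zero))))
    ≡⟨ sum-map-cong (λ x → cong₂ _*_ (cong (λ n → n C (m zero ∸ x)) (ℕP.+-identityʳ c))
         (trans (boxFormula-cong k (m ∘ suc) (λ a p v → cong (λ n → n C (m (suc a) ∸ v)) (sym (ℕP.+-assoc c x p))))
                (lpsFormula≡count k (c + x) (m ∘ suc)))) (upTo (suc (m zero))) ⟩
  sum (map (λ x → (c C (m zero ∸ x)) * Lps.count k (c + x) (m ∘ suc)) (upTo (suc (m zero))))
    ≡⟨ sum-applyUpTo (λ x → (c C (m zero ∸ x)) * Lps.count k (c + x) (m ∘ suc)) id (suc (m zero)) ⟩
  Lps.count (suc k) c m ∎
  where open ≡-Reasoning

sumFin-0C : ∀ M (f : ℕ → ℕ) → sumFin (suc M) (λ i → (0 C (M ∸ toℕ i)) * f (toℕ i)) ≡ f M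
sumFin-0C zero    f = trans (ℕP.+-identityʳ _) (ℕP.+-identityʳ (f 0))
sumFin-0C (suc M) f = sumFin-0C M (f ∘ suc)

-- Peeling the least symbol off a tableau without headless columns leaves m₁ of them for lps and
-- exactly one for rps; the closed formulas start from that state.
Lformula≡count : ∀ k m → Lformula k m ≡ Lps.count (suc k) 0 m
Lformula≡count k m = trans (lpsFormula≡count k (m zero) (m ∘ suc)) (sym (sumFin-0C (m zero) (λ x → Lps.count k x (m ∘ suc))))

multichoose-suc-Fin2 : ∀ d M (i : Fin 2) → 0 ℕ.< M → multichoose (suc (d + toℕ i)) (M ∸ toℕ i) ≡ (M + d) C (M ∸ toℕ i)
multichoose-suc-Fin2 d M       zero       _ = trans (multichoose-suc (d + 0) M) (cong (λ n → (M + n) C M) (ℕP.+-identityʳ d))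
multichoose-suc-Fin2 d (suc r) (suc zero) _ = trans (multichoose-suc (d + 1) r)
  (cong (_C r) (trans (cong (r +_) (ℕP.+-comm d 1)) (ℕP.+-suc r d)))

rpsFormula : ∀ k → ℕ → (Fin k → ℕ) → ℕ
rpsFormula k d m = boxFormula k (λ _ → 1) (λ a p v → (m a + (d + p)) C (m a ∸ v))

rpsFormula≡count : ∀ k d m → (∀ a → 0 ℕ.< m a) → rpsFormula k d m ≡ Rps.count k (suc d) m
rpsFormula≡count zero    d m _   = refl
rpsFormula≡count (suc k) d m pos = begin
  rpsFormula (suc k) d m
    ≡⟨ boxFormula-suc k (λ _ → 1) (λ a p v → (m a + (d + p)) C (m a ∸ v)) ⟩
  sum (map (λ x → ((m zero + (d + 0)) C (m zero ∸ x)) *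
                  boxFormula k (λ _ → 1) (λ a p v → (m (suc a) + (d + (x + p))) C (m (suc a) ∸ v)))
           (upTo 2))
    ≡⟨ sum-map-cong (λ x → cong₂ _*_ (cong (λ n → (m zero + n) C (m zero ∸ x)) (ℕP.+-identityʳ d))
         (trans (boxFormula-cong k (λ _ → 1) (λ a p v → cong (λ n → (m (suc a) + n) C (m (suc a) ∸ v)) (sym (ℕP.+-assoc d x p))))
                (rpsFormula≡count k (d + x) (m ∘ suc) (pos ∘ suc)))) (upTo 2) ⟩
  sum (map (λ x → ((m zero + d) C (m zero ∸ x)) * Rps.count k (suc (d + x)) (m ∘ suc)) (upTo 2))
    ≡⟨ sum-applyUpTo (λ x → ((m zero + d) C (m zero ∸ x)) * Rps.count k (suc (d + x)) (m ∘ suc)) id 2 ⟩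
  sumFin 2 (λ i → ((m zero + d) C (m zero ∸ toℕ i)) * Rps.count k (suc (d + toℕ i)) (m ∘ suc))
    ≡⟨ sumFin-cong 2 (λ i → cong (_* Rps.count k (suc (d + toℕ i)) (m ∘ suc))
                                  (sym (multichoose-suc-Fin2 d (m zero) i (pos zero)))) ⟩
  Rps.count (suc k) (suc d) m ∎
  where open ≡-Reasoning

Rps-count-suc-0 : ∀ k m → 0 ℕ.< m zero → Rps.count (suc k) 0 m ≡ Rps.count k 1 (m ∘ suc)
Rps-count-suc-0 k m pos with m zero | pos
... | suc r | _ = begin
  multichoose 1 r * Rps.count k 1 (m ∘ suc) + 0 ≡⟨ ℕP.+-identityʳ _ ⟩
  multichoose 1 r * Rps.count k 1 (m ∘ suc)     ≡⟨ cong (_* Rps.count k 1 (m ∘ suc)) (multichoose-1 r) ⟩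
  1 * Rps.count k 1 (m ∘ suc)                   ≡⟨ ℕP.*-identityˡ _ ⟩
  Rps.count k 1 (m ∘ suc)                       ∎
  where open ≡-Reasoning

Rformula≡count : ∀ k m → (∀ a → 0 ℕ.< m a) → Rformula k m ≡ Rps.count (suc k) 0 m
Rformula≡count k m pos = trans (rpsFormula≡count k 0 (m ∘ suc) (pos ∘ suc)) (sym (Rps-count-suc-0 k m (pos zero)))

proposition4p5 : (k : ℕ) → (m : Fin (suc k) → ℕ) → (∀ a → 0 < m a) →
    (LPS (suc k) m ↔ Fin (Lformula k m)) × (RPS (suc k) m ↔ Fin (Rformula k m))
proposition4p5 k m pos =
  ↔-trans (Lps.tableau-↔-partialTableau (suc k) m)
    (↔-trans (Lps.partialTableau-↔-Fin (suc k) 0 m) (Fin-cong (sym (Lformula≡count k m)))) ,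
  ↔-trans (Rps.tableau-↔-partialTableau (suc k) m)
    (↔-trans (Rps.partialTableau-↔-Fin (suc k) 0 m pos) (Fin-cong (sym (Rformula≡count k m pos))))
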